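{- Let $u =(u_1,\ldots,u_{m+n-1}) \in \mathsf{Stable}(D_{m,n})$. (a) $u \in \mathsf{Rec}(D_{m,n})$ iff $f_{m,n}(u)$ is a parallelogram polyomino whose bounding rectangle is $[0,m]\times[0,n]$. (b) If $u \in \mathsf{Rec}(D_{m,n})$ then $\mathsf{bounce}(f_{m,n}(u))=\mathsf{canontop}(u)$.
   Context: A parallelogram polyomino is a polyomino whose intersection with every line of slope $-1$ is a connected segment; one with bounding rectangle $[0,m]\times[0,n]$ is described by a pair of lattice paths (upper, lower) from $(0,0)$ to $(m,n)$ with unit north/east steps meeting only at their endpoints. $D_{m,n}$ is the directed graph on $v_0,\ldots,v_{m+n-1}$ with arcs $(v_i,v_j)$ whenever one of $i,j$ lies in $\{0,\ldots,m-1\}$ (top vertices) and the other in $\{m,\ldots,m+n-1\}$ (bottom vertices); $v_0$ is the sink. A configuration assigns $u_i\in\mathbb{N}_0$ grains to $v_i$, $i\ge1$; a vertex with at least as many grains as its out-degree topples, sending one grain along each out-arc. Stable configurations have no unstable non-sink vertex; recurrent ones are $\sigma(x)$ (the stabilisation) for some $x$ with all $x_i\ge d_i$. $\mathsf{inc}_{m,n}(u)=(a_1,\ldots,a_{m-1},b_1,\ldots,b_n)$ is obtained by sorting the top heights $u_1,\dots,u_{m-1}$ and the bottom heights $u_m,\dots,u_{m+n-1}$ separately in weakly increasing order. $f_{m,n}(u)$ is the set of cells given by the intersection of the Young diagram with corner at $(m,0)$ having column heights $(n,1+a_{m-1},\ldots,1+a_1)$ from right to left and the Young diagram with corner at $(0,n)$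 having row widths $(1+b_n,\ldots,1+b_1)$ from top to bottom. For a parallelogram polyomino $\mathcal P$ in $[0,m]\times[0,n]$, the bounce path starts at $(m-1,n)$, goes south until it meets a vertex of the lower path, then west until it meets a vertex of the upper path, then south again, etc., until $(0,0)$; $\mathsf{bounce}(\mathcal P)=(c_1,c_2,\ldots)$ lists the lengths of its successive maximal runs (first the south run). The canonical toppling: add one grain to each bottom vertex; let $Q_1$ be the unstable bottom vertices, topple them; $P_1$ the then unstable top vertices, topple them; $Q_2$ the unstable bottom vertices, etc., until stable; $\mathsf{canontop}(u)=(|Q_1|,|P_1|,|Q_2|,|P_2|,\ldots)$. -}

module Defs where

open import Data.Nat using (ℕ; zero; suc; _+_; _∸_; _≤_; _<_; pred; _≤?_)
open import Data.Nat.Properties using (≤-decTotalOrder)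
open import Data.Bool using (Bool; true; false; if_then_else_; _∧_)
open import Data.Bool.Properties using () renaming (_≟_ to _≟𝔹_)
open import Data.Fin using (Fin; toℕ; splitAt; _↑ˡ_; _↑ʳ_; _≟_)
open import Data.List using (List; []; _∷_; map; _++_; length; lookup; filterᵇ; foldl; tabulate; upTo; allFin)
open import Data.List.Membership.Propositional using (_∈_; _∉_)
open import Data.List.Sort ≤-decTotalOrder using (sort)
open import Data.Product using (Σ; ∃; _×_; _,_)
open import Data.Sum using (_⊎_; inj₁; inj₂)
open import Relation.Nullary using (¬_; Dec; yes; no)
open import Relation.Nullary.Decidable using (⌊_⌋)
open import Relation.Binary.PropositionalEquality using (_≡_)
open import Relation.Binary.Construct.Closure.ReflexiveTransitive using (Star)

-- Vertices v_0,…,v_{m+n-1}; v_0 is the sink.  Non-sink vertices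
-- v_1,…,v_{m+n-1} are indexed by  k : Fin (pred m + n)  (k ↦ v_{k+1}).
-- Indices  i ↑ˡ n  (i : Fin (pred m)) are the non-sink top vertices
-- v_1,…,v_{m-1}; indices  pred m ↑ʳ j  (j : Fin n) are the bottom
-- vertices v_m,…,v_{m+n-1}.

NonSink : ℕ → ℕ → Set
NonSink m n = Fin (pred m + n)

Config : ℕ → ℕ → Set
Config m n = NonSink m n → ℕ

isTop : (m n : ℕ) → NonSink m n → Bool
isTop m n k with splitAt (pred m) k
... | inj₁ _ = true
... | inj₂ _ = false

-- out-degree: a top vertex points to all n bottom vertices,
-- a bottom vertex points to all m top vertices (including the sink)
deg : (m n : ℕ) → NonSink m n → ℕ
deg m n k = if isTop m n k then n else m

arc : (m n : ℕ) → NonSink m n → NonSink m n → Bool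
arc m n v w with isTop m n v | isTop m n w
... | true  | false = true
... | false | true  = true
... | _     | _     = false

-- toppling vertex v (one grain along each out-arc; grains sent to
-- the sink disappear)
topple : (m n : ℕ) → Config m n → NonSink m n → Config m n
topple m n u v w with w ≟ v
... | yes _ = u w ∸ deg m n v
... | no _  = if arc m n v w then suc (u w) else u w

Unstable : (m n : ℕ) → Config m n → NonSink m n → Set
Unstable m n u v = deg m n v ≤ u v

IsStable : (m n : ℕ) → Config m n → Set
IsStable m n u = ∀ v → u v < deg m n v

Step : (m n : ℕ) → Config m n → Config m n → Set
Step m n u u' = Σ (NonSink m n) λ v → Unstable m n u v × (∀ w → u' w ≡ topple m n u v w)

-- s = σ(x): s is stable and reachable from x by legal topplings
-- (by the abelian property this determines σ(x) uniquely)
Stabilises : (m n : ℕ) → Config m n → Config m n → Set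
Stabilises m n x s = Star (Step m n) x s × IsStable m n s

IsRecurrent : (m n : ℕ) → Config m n → Set
IsRecurrent m n u = Σ (Config m n) λ x → (∀ v → deg m n v ≤ x v) × Stabilises m n x u

topHeights : (m n : ℕ) → Config m n → List ℕ
topHeights m n u = tabulate (λ (i : Fin (pred m)) → u (i ↑ˡ n))

botHeights : (m n : ℕ) → Config m n → List ℕ
botHeights m n u = tabulate (λ (j : Fin n) → u (pred m ↑ʳ j))

incTop : (m n : ℕ) → Config m n → List ℕ
incTop m n u = sort (topHeights m n u)

incBot : (m n : ℕ) → Config m n → List ℕ
incBot m n u = sort (botHeights m n u)

-- column heights, listed from left (column [0,1]) to right (column [m-1,m]):
-- (1+a_1, …, 1+a_{m-1}, n)
colHeights : (m n : ℕ) → Config m n → List ℕ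
colHeights m n u = map suc (incTop m n u) ++ (n ∷ [])

-- row widths, listed from bottom (row [0,1]) to top (row [n-1,n]):
-- (1+b_1, …, 1+b_n)
rowWidths : (m n : ℕ) → Config m n → List ℕ
rowWidths m n u = map suc (incBot m n u)

-- a set of unit cells; the cell [x,x+1]×[y,y+1] is named by (x , y)
Cells : Set₁
Cells = ℕ → ℕ → Set

-- Young diagram with corner (m,0): cell (x,y) iff y < height of column x
youngCol : List ℕ → Cells
youngCol hs x y = Σ (Fin (length hs)) λ i → toℕ i ≡ x × y < lookup hs i

-- Young diagram with corner (0,n): cell (x,y) iff x < width of row y
youngRow : List ℕ → Cells
youngRow ws x y = Σ (Fin (length ws)) λ i → toℕ i ≡ y × x < lookup ws i

f : (m n : ℕ) → Config m n → Cells
f m n u x y = youngCol (colHeights m n u) x y × youngRow (rowWidths m n u) x y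

data NE : Set where
  N E : NE

verticesFrom : ℕ → ℕ → List NE → List (ℕ × ℕ)
verticesFrom x y []      = (x , y) ∷ []
verticesFrom x y (N ∷ s) = (x , y) ∷ verticesFrom x (suc y) s
verticesFrom x y (E ∷ s) = (x , y) ∷ verticesFrom (suc x) y s

eastStepsFrom : ℕ → ℕ → List NE → List (ℕ × ℕ)
eastStepsFrom x y []      = []
eastStepsFrom x y (N ∷ s) = eastStepsFrom x (suc y) s
eastStepsFrom x y (E ∷ s) = (x , y) ∷ eastStepsFrom (suc x) y s

vertices : List NE → List (ℕ × ℕ)
vertices = verticesFrom 0 0

eastSteps : List NE → List (ℕ × ℕ)
eastSteps = eastStepsFrom 0 0

countN countE : List NE → ℕ
countN []      = 0
countN (N ∷ s) = suc (countN s)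
countN (E ∷ s) = countN s
countE []      = 0
countE (N ∷ s) = countE s
countE (E ∷ s) = suc (countE s)

IsPath : ℕ → ℕ → List NE → Set
IsPath m n p = countE p ≡ m × countN p ≡ n

IsPathPair : ℕ → ℕ → List NE → List NE → Set
IsPathPair m n U L =
  IsPath m n U × IsPath m n L ×
  (Σ (List NE) λ U' → U ≡ N ∷ U') × (Σ (List NE) λ L' → L ≡ E ∷ L') ×
  (∀ p → p ∈ vertices U → p ∈ vertices L → p ≡ (0 , 0) ⊎ p ≡ (m , n))

Between : List NE → List NE → Cells
Between U L x y =
  (Σ ℕ λ h → (x , h) ∈ eastSteps U × y < h) ×
  (Σ ℕ λ h → (x , h) ∈ eastSteps L × h ≤ y)

Describes : ℕ → ℕ → Cells → List NE → List NE → Set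
Describes m n S U L = IsPathPair m n U L × (∀ x y → (S x y → Between U L x y) × (Between U L x y → S x y))

IsParallelogramPolyomino : ℕ → ℕ → Cells → Set
IsParallelogramPolyomino m n S = Σ (List NE) λ U → Σ (List NE) λ L → Describes m n S U L

-- Bounce path.  Bounce U L d x y cs : the bounce path, currently at
-- (x , y) and about to move in direction d, has remaining run lengths cs.

data Dir : Set where
  south west : Dir

data Bounce (U L : List NE) : Dir → ℕ → ℕ → List ℕ → Set where
  stop  : ∀ {d} → Bounce U L d 0 0 []
  southRun : ∀ {x y cs} (k : ℕ) → 1 ≤ k → k ≤ y →
    (x , y ∸ k) ∈ vertices L →
    (∀ j → 1 ≤ j → j < k → (x , y ∸ j) ∉ vertices L) →
    Bounce U L west x (y ∸ k) cs → Bounce U L south x y (k ∷ cs)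
  westRun : ∀ {x y cs} (k : ℕ) → 1 ≤ k → k ≤ x →
    (x ∸ k , y) ∈ vertices U →
    (∀ j → 1 ≤ j → j < k → (x ∸ j , y) ∉ vertices U) →
    Bounce U L south (x ∸ k) y cs → Bounce U L west x y (k ∷ cs)

IsBounce : ℕ → ℕ → List NE → List NE → List ℕ → Set
IsBounce m n U L cs = Bounce U L south (pred m) n cs

-- the unstable vertices of configuration c on the given side
-- (true = top, false = bottom), in increasing order of index
isUnstableᵇ : (m n : ℕ) → Config m n → NonSink m n → Bool
isUnstableᵇ m n c v = ⌊ deg m n v ≤? c v ⌋

unstableOn : (m n : ℕ) → Bool → Config m n → List (NonSink m n)
unstableOn m n s c =
  filterᵇ (λ v → ⌊ isTop m n v ≟𝔹 s ⌋ ∧ isUnstableᵇ m n c v) (allFin (pred m + n))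

-- side toppled in round k: rounds 0,2,4,… bottom (Q_1,Q_2,…),
-- rounds 1,3,5,… top (P_1,P_2,…)
sideOf : ℕ → Bool
sideOf zero          = false
sideOf (suc zero)    = true
sideOf (suc (suc k)) = sideOf k

canonStart : (m n : ℕ) → Config m n → Config m n
canonStart m n u v = if isTop m n v then u v else suc (u v)

canonConf : (m n : ℕ) → Config m n → ℕ → Config m n
canonConf m n u zero    = canonStart m n u
canonConf m n u (suc k) =
  foldl (topple m n) (canonConf m n u k) (unstableOn m n (sideOf k) (canonConf m n u k))

canonCount : (m n : ℕ) → Config m n → ℕ → ℕ
canonCount m n u k = length (unstableOn m n (sideOf k) (canonConf m n u k))

IsCanonTop : (m n : ℕ) → Config m n → List ℕ → Set
IsCanonTop m n u cs =
  Σ ℕ λ K → IsStable m n (canonConf m n u K) ×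
    (∀ k → k < K → ¬ IsStable m n (canonConf m n u k)) ×
    cs ≡ map (canonCount m n u) (upTo K)

module Submission where

-- Write m = t + 1 and fix a stable configuration u on D_{m,n}.
-- Everything is governed by the two counting functions
--     A Y = #{top vertices of height < Y},   B X = #{bottom vertices of height < X}.
-- (1) Sorting turns f_{m,n}(u) into the cell set {(x,y) | x < m, y < n, A y ≤ x, B x ≤ y}.
-- (2) Condition C says  A (B X) < X  for 0 < X < m.  Under C the lower path has the
--     east step of column x at height B x and the upper path at the height given by
--     inc(u); conversely any pair of paths describing f_{m,n}(u) forces C.
-- (3) For thresholds with A Y ≤ X and B X ≤ Y there is an explicit configuration
--     conf X Y; conf m n is the start of the canonical toppling, a bottom round turns
--     conf X Y into conf (A Y) Y, a top round turns it into conf X (B X), and the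
--     numbers of toppled vertices are B X ∸ B (A Y) and A Y ∸ A (B X).  So under C
--     the canonical toppling and the bounce path run through the same thresholds;
--     this gives part (b), and the process ends in conf 0 0 = u.
-- (4) C ⇒ recurrent: the canonical toppling returns u plus one grain per bottom
--     vertex to u, which lets us stabilise u + deg back to u.
--     Recurrent ⇒ C: if C fails, the low top and low bottom vertices form a
--     forbidden subconfiguration that no toppling sequence from x ≥ deg can reach.

open import Defs
open import Data.Nat
open import Data.Nat.Properties
open import Data.Bool using (Bool; true; false; if_then_else_; _∧_; not)
open import Data.Bool.Properties using (not-¬) renaming (_≟_ to _≟𝔹_)
open import Data.Fin using (Fin; toℕ; fromℕ<; splitAt; _↑ˡ_; _↑ʳ_)
  renaming (zero to fzero; suc to fsuc; _≟_ to _≟F_)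
open import Data.Fin.Properties
  using (toℕ-fromℕ<; toℕ<n; splitAt-↑ˡ; splitAt-↑ʳ; splitAt⁻¹-↑ˡ; splitAt⁻¹-↑ʳ)
open import Data.Unit using (⊤; tt)
open import Data.List
  using (List; []; _∷_; map; _++_; length; lookup; filterᵇ; foldl; tabulate; applyUpTo; allFin)
open import Data.List.Properties using (foldl-++; length-tabulate; length-map; length-++)
open import Data.List.Membership.Propositional using (_∈_; _∉_)
open import Data.List.Membership.Propositional.Properties using (∈-allFin)
open import Data.List.Relation.Unary.Any using (here; there)
open import Data.List.Relation.Unary.All using (All; []; _∷_)
import Data.List.Relation.Unary.All as All
open import Data.List.Relation.Unary.Linked using (Linked; []; [-]; _∷_)
open import Data.List.Relation.Unary.AllPairs using ([]; _∷_)
open import Data.List.Relation.Unary.Unique.Propositional using (Unique)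
open import Data.List.Relation.Unary.Unique.Propositional.Properties using (allFin⁺)
import Data.List.Relation.Binary.Permutation.Propositional as Perm
open Perm using (_↭_; prep; swap)
open import Data.List.Relation.Binary.Permutation.Propositional.Properties using (↭-length)
open import Data.List.Sort ≤-decTotalOrder using (sort; sort-↭; sort-↗)
open import Data.Product using (Σ; _×_; _,_; proj₁; proj₂)
open import Data.Sum using (_⊎_; inj₁; inj₂)
open import Data.Empty using (⊥; ⊥-elim)
open import Relation.Nullary using (¬_; Dec; yes; no)
open import Relation.Nullary.Decidable using (⌊_⌋)
open import Relation.Binary.PropositionalEquality
open import Relation.Binary.Construct.Closure.ReflexiveTransitive using (Star; ε; _◅_)
open import Function using (_∘_)

count : {A : Set} → (A → Bool) → List A → ℕ
count p []       = 0
count p (x ∷ xs) = if p x then suc (count p xs) else count p xs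

length-filterᵇ : {A : Set} (p : A → Bool) (xs : List A) → length (filterᵇ p xs) ≡ count p xs
length-filterᵇ p [] = refl
length-filterᵇ p (x ∷ xs) with p x
... | true  = cong suc (length-filterᵇ p xs)
... | false = length-filterᵇ p xs

count-++ : {A : Set} (p : A → Bool) (xs ys : List A) → count p (xs ++ ys) ≡ count p xs + count p ys
count-++ p [] ys = refl
count-++ p (x ∷ xs) ys with p x
... | true  = cong suc (count-++ p xs ys)
... | false = count-++ p xs ys

count-tabulate : {A : Set} {k : ℕ} (p : A → Bool) (g : Fin k → A) →
  count p (tabulate g) ≡ count (p ∘ g) (allFin k)
count-tabulate {k = zero}  p g = refl
count-tabulate {k = suc k} p g with p (g fzero)
... | true  = cong suc (trans (count-tabulate p (g ∘ fsuc)) (sym (count-tabulate (p ∘ g) fsuc)))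
... | false = trans (count-tabulate p (g ∘ fsuc)) (sym (count-tabulate (p ∘ g) fsuc))

count-cong : {A : Set} (p q : A → Bool) (xs : List A) →
  (∀ x → x ∈ xs → p x ≡ q x) → count p xs ≡ count q xs
count-cong p q [] h = refl
count-cong p q (x ∷ xs) h with p x | q x | h x (here refl)
... | true  | true  | _ = cong suc (count-cong p q xs (λ y y∈ → h y (there y∈)))
... | false | false | _ = count-cong p q xs (λ y y∈ → h y (there y∈))

count≤length : {A : Set} (p : A → Bool) (xs : List A) → count p xs ≤ length xs
count≤length p [] = z≤n
count≤length p (x ∷ xs) with p x
... | true  = s≤s (count≤length p xs)
... | false = m≤n⇒m≤1+n (count≤length p xs)

count-all : {A : Set} (p : A → Bool) (xs : List A) →
  (∀ x → x ∈ xs → p x ≡ true) → count p xs ≡ length xs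
count-all p [] h = refl
count-all p (x ∷ xs) h with p x | h x (here refl)
... | true | _ = cong suc (count-all p xs (λ y y∈ → h y (there y∈)))

count-none : {A : Set} (p : A → Bool) (xs : List A) →
  (∀ x → x ∈ xs → p x ≡ false) → count p xs ≡ 0
count-none p [] h = refl
count-none p (x ∷ xs) h with p x | h x (here refl)
... | false | _ = count-none p xs (λ y y∈ → h y (there y∈))

count-mono : {A : Set} (p q : A → Bool) (xs : List A) →
  (∀ x → p x ≡ true → q x ≡ true) → count p xs ≤ count q xs
count-mono p q [] h = z≤n
count-mono p q (x ∷ xs) h with p x | q x | h x
... | true  | true  | _ = s≤s (count-mono p q xs h)
... | true  | false | hx with () ← hx refl
... | false | true  | _ = m≤n⇒m≤1+n (count-mono p q xs h)
... | false | false | _ = count-mono p q xs h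

count-split : {A : Set} (p q : A → Bool) (xs : List A) →
  count p xs ≡ count (λ x → p x ∧ q x) xs + count (λ x → p x ∧ not (q x)) xs
count-split p q [] = refl
count-split p q (x ∷ xs) with p x | q x
... | true  | true  = cong suc (count-split p q xs)
... | true  | false = trans (cong suc (count-split p q xs)) (sym (+-suc _ _))
... | false | true  = count-split p q xs
... | false | false = count-split p q xs

count-witness : {A : Set} (p : A → Bool) (xs : List A) → 0 < count p xs →
  Σ A λ x → x ∈ xs × p x ≡ true
count-witness p (x ∷ xs) h with p x in eq
... | true  = x , here refl , eq
... | false with count-witness p xs h
... | y , y∈ , py = y , there y∈ , py

count-positive : {A : Set} (p : A → Bool) (xs : List A) (x : A) → x ∈ xs → p x ≡ true → 0 < count p xs
count-positive p (y ∷ xs) x (here refl) px rewrite px = s≤s z≤n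
count-positive p (y ∷ xs) x (there x∈) px with p y
... | true  = s≤s z≤n
... | false = count-positive p xs x x∈ px

count-↭ : {A : Set} (p : A → Bool) {xs ys : List A} → xs ↭ ys → count p xs ≡ count p ys
count-↭ p Perm.refl = refl
count-↭ p (prep x r) with p x
... | true  = cong suc (count-↭ p r)
... | false = count-↭ p r
count-↭ p (swap x y r) with p x | p y
... | true  | true  = cong (suc ∘ suc) (count-↭ p r)
... | true  | false = cong suc (count-↭ p r)
... | false | true  = cong suc (count-↭ p r)
... | false | false = count-↭ p r
count-↭ p (Perm.trans r s) = trans (count-↭ p r) (count-↭ p s)

tabulate-+ : {A : Set} (k n : ℕ) (g : Fin (k + n) → A) →
  tabulate g ≡ tabulate (λ i → g (i ↑ˡ n)) ++ tabulate (λ j → g (k ↑ʳ j))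
tabulate-+ zero    n g = refl
tabulate-+ (suc k) n g = cong (g fzero ∷_) (tabulate-+ k n (g ∘ fsuc))

∈-filterᵇ⁻ : {A : Set} (p : A → Bool) {x : A} {xs : List A} → x ∈ filterᵇ p xs → x ∈ xs × p x ≡ true
∈-filterᵇ⁻ p {x} {y ∷ xs} h with p y in eq
∈-filterᵇ⁻ p {x} {y ∷ xs} (here refl) | true = here refl , eq
∈-filterᵇ⁻ p {x} {y ∷ xs} (there h)   | true with ∈-filterᵇ⁻ p h
... | a , b = there a , b
∈-filterᵇ⁻ p {x} {y ∷ xs} h | false with ∈-filterᵇ⁻ p h
... | a , b = there a , b

∈-filterᵇ⁺ : {A : Set} (p : A → Bool) {x : A} {xs : List A} → x ∈ xs → p x ≡ true → x ∈ filterᵇ p xs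
∈-filterᵇ⁺ p {x} {y ∷ xs} (here refl) px rewrite px = here refl
∈-filterᵇ⁺ p {x} {y ∷ xs} (there h) px with p y
... | true  = there (∈-filterᵇ⁺ p h px)
... | false = ∈-filterᵇ⁺ p h px

All-filterᵇ : {A : Set} (p : A → Bool) {P : A → Set} {xs : List A} → All P xs → All P (filterᵇ p xs)
All-filterᵇ p [] = []
All-filterᵇ p {xs = y ∷ xs} (py ∷ ps) with p y
... | true  = py ∷ All-filterᵇ p ps
... | false = All-filterᵇ p ps

Unique-filterᵇ : {A : Set} (p : A → Bool) {xs : List A} → Unique xs → Unique (filterᵇ p xs)
Unique-filterᵇ p [] = []
Unique-filterᵇ p {y ∷ xs} (h ∷ u) with p y
... | true  = All-filterᵇ p h ∷ Unique-filterᵇ p u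
... | false = Unique-filterᵇ p u

∈-tail : {A : Set} {x y : A} {xs : List A} → x ∈ y ∷ xs → x ≢ y → x ∈ xs
∈-tail (here e)  ne = ⊥-elim (ne e)
∈-tail (there h) _  = h

All-from-∈ : {A : Set} {P : A → Set} {xs : List A} → (∀ x → x ∈ xs → P x) → All P xs
All-from-∈ {xs = []}     h = []
All-from-∈ {xs = x ∷ xs} h = h x (here refl) ∷ All-from-∈ (λ y y∈ → h y (there y∈))

isYes⇒ : {P : Set} (d : Dec P) → ⌊ d ⌋ ≡ true → P
isYes⇒ (yes p) _ = p

⇒isYes : {P : Set} (d : Dec P) → P → ⌊ d ⌋ ≡ true
⇒isYes (yes _) _ = refl
⇒isYes (no ¬p) p = ⊥-elim (¬p p)

∧-elim : ∀ {a b} → a ∧ b ≡ true → a ≡ true × b ≡ true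
∧-elim {true} {true} _ = refl , refl

∧-intro : ∀ {a b} → a ≡ true → b ≡ true → a ∧ b ≡ true
∧-intro refl refl = refl

not-false : ∀ {a} → a ≡ false → not a ≡ true
not-false refl = refl

Bool-ext : ∀ {x y : Bool} → (x ≡ true → y ≡ true) → (y ≡ true → x ≡ true) → x ≡ y
Bool-ext {true}  {true}  f g = refl
Bool-ext {true}  {false} f g = sym (f refl)
Bool-ext {false} {true}  f g = g refl
Bool-ext {false} {false} f g = refl

range : ℕ → ℕ → List ℕ
range j zero    = []
range j (suc r) = j ∷ range (suc j) r

applyUpTo≡range : ∀ (g : ℕ → ℕ) j k → (∀ i → g i ≡ j + i) → applyUpTo g k ≡ range j k
applyUpTo≡range g j zero    h = refl
applyUpTo≡range g j (suc k) h =
  cong₂ _∷_ (trans (h 0) (+-identityʳ j)) (applyUpTo≡range (g ∘ suc) (suc j) k (λ i → trans (h (suc i)) (+-suc j i)))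

someFin : ∀ {k} → 1 ≤ k → Fin k
someFin {suc k} _ = fzero

[a∸b]+[b∸c]≡a∸c : ∀ {a b c} → c ≤ b → b ≤ a → (a ∸ b) + (b ∸ c) ≡ a ∸ c
[a∸b]+[b∸c]≡a∸c {a} {b} {c} c≤b b≤a = begin
  (a ∸ b) + (b ∸ c)  ≡⟨ sym (+-∸-assoc (a ∸ b) c≤b) ⟩
  (a ∸ b) + b ∸ c    ≡⟨ cong (_∸ c) (m∸n+n≡m b≤a) ⟩
  a ∸ c              ∎
  where open ≡-Reasoning

[a+[M∸b]]∸M≡a∸b : ∀ {a b M} → b ≤ a → b ≤ M → (a + (M ∸ b)) ∸ M ≡ a ∸ b
[a+[M∸b]]∸M≡a∸b {a} {b} {M} b≤a b≤M = begin
  a + (M ∸ b) ∸ M    ≡⟨ cong (_∸ M) (sym (+-∸-assoc a b≤M)) ⟩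
  a + M ∸ b ∸ M      ≡⟨ cong (_∸ M) (+-∸-comm M b≤a) ⟩
  (a ∸ b) + M ∸ M    ≡⟨ m+n∸n≡m (a ∸ b) M ⟩
  a ∸ b              ∎
  where open ≡-Reasoning

M≤a+[M∸b]⇒b≤a : ∀ {a b M} → b ≤ M → M ≤ a + (M ∸ b) → b ≤ a
M≤a+[M∸b]⇒b≤a {a} {b} {M} b≤M h =
  subst (_≤ a) (m∸[m∸n]≡n b≤M) (m≤n+o⇒m∸n≤o M (M ∸ b) (subst (M ≤_) (+-comm a (M ∸ b)) h))

b≤a⇒M≤a+[M∸b] : ∀ {a b M} → b ≤ a → b ≤ M → M ≤ a + (M ∸ b)
b≤a⇒M≤a+[M∸b] {a} {b} {M} b≤a b≤M = subst (_≤ a + (M ∸ b)) (m+[n∸m]≡n b≤M) (+-monoˡ-≤ (M ∸ b) b≤a)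

a∸b<M : ∀ a b {M} → a < M → a ∸ b < M
a∸b<M a b h = ≤-<-trans (m∸n≤m a b) h

j<y∸b⇒b≤y : ∀ {y b j} → j < y ∸ b → b ≤ y
j<y∸b⇒b≤y {y} {b} {j} h with b ≤? y
... | yes p = p
... | no ¬p rewrite m≤n⇒m∸n≡0 (<⇒≤ (≰⇒> ¬p)) with h
... | ()

j<y∸b⇒b<y∸j : ∀ {y b j} → j < y ∸ b → b < y ∸ j
j<y∸b⇒b<y∸j {y} {b} {j} h =
  m+n≤o⇒m≤o∸n (suc b)
    (subst (_≤ y) (trans (+-comm (suc j) b) (+-suc b j)) (m≤o∸n⇒m+n≤o (suc j) (j<y∸b⇒b≤y h) h))

<-bound⇒≤ : ∀ {p q} → (∀ y → y < p → y < q) → p ≤ q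
<-bound⇒≤ {zero}  h = z≤n
<-bound⇒≤ {suc p} h = h p (n<1+n p)

-- On a sorted list, the count of elements below X is the
-- position where X is exceeded, which is how inc_{m,n} enters.

below : ℕ → ℕ → Bool
below X e = ⌊ e <? X ⌋

below-true : ∀ {X e} → e < X → below X e ≡ true
below-true {X} {e} h with e <? X
... | yes _ = refl
... | no ¬h = ⊥-elim (¬h h)

below-false : ∀ {X e} → ¬ e < X → below X e ≡ false
below-false {X} {e} h with e <? X
... | yes p = ⊥-elim (h p)
... | no _  = refl

below-true⁻ : ∀ {X e} → below X e ≡ true → e < X
below-true⁻ {X} {e} h = isYes⇒ (e <? X) h

below-false⁻ : ∀ {X e} → not (below X e) ≡ true → X ≤ e
below-false⁻ {X} {e} h with e <? X
... | no ¬p = ≮⇒≥ ¬p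

-- positions in a list of naturals (0 outside the list)
nth : List ℕ → ℕ → ℕ
nth []       _       = 0
nth (x ∷ xs) zero    = x
nth (x ∷ xs) (suc i) = nth xs i

lookup-nth : (xs : List ℕ) (i : Fin (length xs)) → lookup xs i ≡ nth xs (toℕ i)
lookup-nth (x ∷ xs) fzero    = refl
lookup-nth (x ∷ xs) (fsuc i) = lookup-nth xs i

nth-∈ : (s : List ℕ) (i : ℕ) → i < length s → nth s i ∈ s
nth-∈ (x ∷ s) zero    _       = here refl
nth-∈ (x ∷ s) (suc i) (s≤s h) = there (nth-∈ s i h)

nth-map-suc : (xs : List ℕ) (i : ℕ) → i < length xs → nth (map suc xs) i ≡ suc (nth xs i)
nth-map-suc (x ∷ xs) zero    _       = refl
nth-map-suc (x ∷ xs) (suc i) (s≤s h) = nth-map-suc xs i h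

nth-++ˡ : (xs ys : List ℕ) (i : ℕ) → i < length xs → nth (xs ++ ys) i ≡ nth xs i
nth-++ˡ (x ∷ xs) ys zero    _       = refl
nth-++ˡ (x ∷ xs) ys (suc i) (s≤s h) = nth-++ˡ xs ys i h

nth-++ʳ : (xs ys : List ℕ) (i : ℕ) → nth (xs ++ ys) (length xs + i) ≡ nth ys i
nth-++ʳ []       ys i = refl
nth-++ʳ (x ∷ xs) ys i = nth-++ʳ xs ys i

fromIndexed : (xs : List ℕ) (x : ℕ) (P : ℕ → Set) →
  (Σ (Fin (length xs)) λ i → toℕ i ≡ x × P (lookup xs i)) → x < length xs × P (nth xs x)
fromIndexed xs x P (i , refl , h) = toℕ<n i , subst P (lookup-nth xs i) h

toIndexed : (xs : List ℕ) (x : ℕ) (P : ℕ → Set) → x < length xs → P (nth xs x) →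
  Σ (Fin (length xs)) λ i → toℕ i ≡ x × P (lookup xs i)
toIndexed xs x P lt h = fromℕ< lt , toℕ-fromℕ< lt ,
  subst P (sym (trans (lookup-nth xs (fromℕ< lt)) (cong (nth xs) (toℕ-fromℕ< lt)))) h

Sorted : List ℕ → Set
Sorted = Linked _≤_

sorted-head≤ : ∀ {a s} → Sorted (a ∷ s) → All (a ≤_) s
sorted-head≤ [-] = []
sorted-head≤ {a} (a≤b ∷ l) = a≤b ∷ All.map (≤-trans a≤b) (sorted-head≤ l)

sorted-tail : ∀ {a s} → Sorted (a ∷ s) → Sorted s
sorted-tail [-]     = []
sorted-tail (_ ∷ l) = l

count-below-none : ∀ X {s} → All (X ≤_) s → count (below X) s ≡ 0
count-below-none X [] = refl
count-below-none X {e ∷ s} (p ∷ ps) rewrite below-false {X} {e} (≤⇒≯ p) = count-below-none X ps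

sorted-below⇒index< : ∀ X (s : List ℕ) → Sorted s → (i : ℕ) → i < length s →
  nth s i < X → i < count (below X) s
sorted-below⇒index< X (a ∷ s) l i lt h with a <? X
sorted-below⇒index< X (a ∷ s) l zero lt h | yes p = s≤s z≤n
sorted-below⇒index< X (a ∷ s) l (suc i) (s≤s lt) h | yes p =
  s≤s (sorted-below⇒index< X s (sorted-tail l) i lt h)
sorted-below⇒index< X (a ∷ s) l zero lt h | no ¬p = ⊥-elim (¬p h)
sorted-below⇒index< X (a ∷ s) l (suc i) (s≤s lt) h | no ¬p =
  ⊥-elim (¬p (≤-<-trans (All.lookup (sorted-head≤ l) (nth-∈ s i lt)) h))

sorted-index<⇒below : ∀ X (s : List ℕ) → Sorted s → (i : ℕ) → i < length s →
  i < count (below X) s → nth s i < X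
sorted-index<⇒below X (a ∷ s) l i lt h with a <? X
sorted-index<⇒below X (a ∷ s) l zero lt h | yes p = p
sorted-index<⇒below X (a ∷ s) l (suc i) (s≤s lt) (s≤s h) | yes p =
  sorted-index<⇒below X s (sorted-tail l) i lt h
sorted-index<⇒below X (a ∷ s) l i lt h | no ¬p
  rewrite count-below-none X {s} (All.map (≤-trans (≮⇒≥ ¬p)) (sorted-head≤ l)) with h
... | ()

sorted-count≤⇔ : ∀ s → Sorted s → ∀ i → i < length s → ∀ y →
  (y ≤ nth s i → count (below y) s ≤ i) × (count (below y) s ≤ i → y ≤ nth s i)
sorted-count≤⇔ s l i il y =
  (λ h → ≮⇒≥ λ lt → <⇒≱ (sorted-index<⇒below y s l i il lt) h) ,
  (λ h → ≮⇒≥ λ lt → <⇒≱ (sorted-below⇒index< y s l i il lt) h)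

module Threshold {α : Set} (h : α → ℕ) where

  countBelow : ℕ → List α → ℕ
  countBelow Y l = count (λ x → below Y (h x)) l

  countBelow-mono : ∀ {Y Y'} l → Y ≤ Y' → countBelow Y l ≤ countBelow Y' l
  countBelow-mono l le = count-mono _ _ l (λ x e → below-true (<-≤-trans (below-true⁻ e) le))

  countBelow-diff : ∀ {Y' Y} l → Y' ≤ Y →
    count (λ x → below Y (h x) ∧ not (below Y' (h x))) l ≡ countBelow Y l ∸ countBelow Y' l
  countBelow-diff {Y'} {Y} l le =
    sym (trans (cong (_∸ countBelow Y' l)
                  (trans (count-split (λ x → below Y (h x)) (λ x → below Y' (h x)) l)
                         (cong (_+ count (λ x → below Y (h x) ∧ not (below Y' (h x))) l) both)))
               (m+n∸m≡n (countBelow Y' l) _))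
    where
    below-∧ : ∀ e → below Y e ∧ below Y' e ≡ below Y' e
    below-∧ e with e <? Y'
    ... | yes p rewrite below-true {Y} {e} (<-≤-trans p le) = refl
    ... | no _ with below Y e
    ... | true  = refl
    ... | false = refl
    both : count (λ x → below Y (h x) ∧ below Y' (h x)) l ≡ countBelow Y' l
    both = count-cong _ _ l (λ x _ → below-∧ (h x))

  countBelow-witness : ∀ {Y' Y} l → Y' ≤ Y → countBelow Y' l < countBelow Y l →
    Σ α λ x → x ∈ l × Y' ≤ h x × h x < Y
  countBelow-witness {Y'} {Y} l le lt
    with count-witness (λ x → below Y (h x) ∧ not (below Y' (h x))) l
           (subst (0 <_) (sym (countBelow-diff l le)) (m<n⇒0<n∸m lt))
  ... | x , x∈ , px with h x <? Y | h x <? Y'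
  ... | yes p | no q  = x , x∈ , ≮⇒≥ q , p
  ... | yes p | yes q with () ← px
  ... | no p  | _     with () ← px

  countBelow-strict : ∀ {Y' Y} l x → x ∈ l → Y' ≤ h x → h x < Y → countBelow Y' l < countBelow Y l
  countBelow-strict {Y'} {Y} l x x∈ a b =
    m∸n≢0⇒n<m λ e → <⇒≢ (subst (0 <_) (countBelow-diff l (<⇒≤ (≤-<-trans a b))) positive) (sym e)
    where
    positive : 0 < count (λ x → below Y (h x) ∧ not (below Y' (h x))) l
    positive = count-positive _ l x x∈ (trans (cong (_∧ _) (below-true b)) (cong not (below-false (≤⇒≯ a))))

,-injective : ∀ {a b c d : ℕ} → (a , b) ≡ (c , d) → a ≡ c × b ≡ d
,-injective refl = refl , refl

east-lower : ∀ x y p {a b} → (a , b) ∈ eastStepsFrom x y p → x ≤ a × y ≤ b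
east-lower x y (N ∷ p) h with east-lower x (suc y) p h
... | l1 , l2 = l1 , <⇒≤ l2
east-lower x y (E ∷ p) (here e) with ,-injective e
... | refl , refl = ≤-refl , ≤-refl
east-lower x y (E ∷ p) (there h) with east-lower (suc x) y p h
... | l1 , l2 = <⇒≤ l1 , l2

vertex-lower : ∀ x y p {a b} → (a , b) ∈ verticesFrom x y p → x ≤ a × y ≤ b
vertex-lower x y [] (here e) with ,-injective e
... | refl , refl = ≤-refl , ≤-refl
vertex-lower x y (N ∷ p) (here e) with ,-injective e
... | refl , refl = ≤-refl , ≤-refl
vertex-lower x y (N ∷ p) (there h) with vertex-lower x (suc y) p h
... | l1 , l2 = l1 , <⇒≤ l2
vertex-lower x y (E ∷ p) (here e) with ,-injective e
... | refl , refl = ≤-refl , ≤-refl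
vertex-lower x y (E ∷ p) (there h) with vertex-lower (suc x) y p h
... | l1 , l2 = <⇒≤ l1 , l2

vertex-upper : ∀ x y p {a b} → (a , b) ∈ verticesFrom x y p → a ≤ x + countE p × b ≤ y + countN p
vertex-upper x y [] (here e) with ,-injective e
... | refl , refl = m≤m+n x 0 , m≤m+n y 0
vertex-upper x y (N ∷ p) (here e) with ,-injective e
... | refl , refl = m≤m+n x _ , m≤m+n y _
vertex-upper x y (N ∷ p) {a} {b} (there h) with vertex-upper x (suc y) p h
... | l1 , l2 = l1 , subst (b ≤_) (sym (+-suc y (countN p))) l2
vertex-upper x y (E ∷ p) (here e) with ,-injective e
... | refl , refl = m≤m+n x _ , m≤m+n y _
vertex-upper x y (E ∷ p) {a} {b} (there h) with vertex-upper (suc x) y p h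
... | l1 , l2 = subst (a ≤_) (sym (+-suc x (countE p))) l1 , l2

east-exists : ∀ x y p a → x ≤ a → a < x + countE p → Σ ℕ λ b → (a , b) ∈ eastStepsFrom x y p
east-exists x y [] a h1 h2 = ⊥-elim (<⇒≱ h2 (subst (_≤ a) (sym (+-identityʳ x)) h1))
east-exists x y (N ∷ p) a h1 h2 = east-exists x (suc y) p a h1 h2
east-exists x y (E ∷ p) a h1 h2 with x ≟ a
... | yes refl = y , here refl
... | no ne with east-exists (suc x) y p a (≤∧≢⇒< h1 ne) (subst (a <_) (+-suc x (countE p)) h2)
... | b , h = b , there h

east-mono : ∀ x y p {a b a' b'} → (a , b) ∈ eastStepsFrom x y p → (a' , b') ∈ eastStepsFrom x y p →
  a ≤ a' → b ≤ b'
east-mono x y (N ∷ p) h h' le = east-mono x (suc y) p h h' le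
east-mono x y (E ∷ p) (here e) h' le with ,-injective e
east-mono x y (E ∷ p) (here e) (here e') le | refl , refl with ,-injective e'
... | refl , refl = ≤-refl
east-mono x y (E ∷ p) (here e) (there h') le | refl , refl = proj₂ (east-lower (suc x) y p h')
east-mono x y (E ∷ p) (there h) (here e') le with ,-injective e'
... | refl , refl = ⊥-elim (<⇒≱ (proj₁ (east-lower (suc x) y p h)) le)
east-mono x y (E ∷ p) (there h) (there h') le = east-mono (suc x) y p h h' le

east-unique : ∀ x y p {a b b'} → (a , b) ∈ eastStepsFrom x y p → (a , b') ∈ eastStepsFrom x y p → b ≡ b'
east-unique x y p h h' = ≤-antisym (east-mono x y p h h' ≤-refl) (east-mono x y p h' h ≤-refl)

east-endpoints : ∀ x y p {a b} → (a , b) ∈ eastStepsFrom x y p →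
  (a , b) ∈ verticesFrom x y p × (suc a , b) ∈ verticesFrom x y p
east-endpoints x y (N ∷ p) h with east-endpoints x (suc y) p h
... | v1 , v2 = there v1 , there v2
east-endpoints x y (E ∷ p) (here e) with ,-injective e
east-endpoints x y (E ∷ [])    (here e) | refl , refl = here refl , there (here refl)
east-endpoints x y (E ∷ N ∷ p) (here e) | refl , refl = here refl , there (here refl)
east-endpoints x y (E ∷ E ∷ p) (here e) | refl , refl = here refl , there (here refl)
east-endpoints x y (E ∷ p) (there h) with east-endpoints (suc x) y p h
... | v1 , v2 = there v1 , there v2

vertex-start : ∀ x y p → (x , y) ∈ verticesFrom x y p
vertex-start x y []      = here refl
vertex-start x y (N ∷ p) = here refl
vertex-start x y (E ∷ p) = here refl

vertex-interval : ∀ x y p {a b1 b2 t} → (a , b1) ∈ verticesFrom x y p → (a , b2) ∈ verticesFrom x y p →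
  b1 ≤ t → t ≤ b2 → (a , t) ∈ verticesFrom x y p
vertex-interval x y [] (here e1) (here e2) l1 l2 with ,-injective e1 | ,-injective e2
... | refl , refl | refl , refl with ≤-antisym l1 l2
... | refl = here refl
vertex-interval x y (N ∷ p) {t = t} (here e1) h2 l1 l2 with ,-injective e1
... | refl , refl with y ≟ t
... | yes refl = here refl
vertex-interval x y (N ∷ p) {t = t} (here e1) (here e2) l1 l2 | refl , refl | no ne with ,-injective e2
... | refl , refl = ⊥-elim (ne (≤-antisym l1 l2))
vertex-interval x y (N ∷ p) {t = t} (here e1) (there h2) l1 l2 | refl , refl | no ne =
  there (vertex-interval x (suc y) p (vertex-start x (suc y) p) h2 (≤∧≢⇒< l1 ne) l2)
vertex-interval x y (N ∷ p) (there h1) (here e2) l1 l2 with ,-injective e2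
... | refl , refl = ⊥-elim (<⇒≱ (proj₂ (vertex-lower x (suc y) p h1)) (≤-trans l1 l2))
vertex-interval x y (N ∷ p) (there h1) (there h2) l1 l2 = there (vertex-interval x (suc y) p h1 h2 l1 l2)
vertex-interval x y (E ∷ p) (here e1) (here e2) l1 l2 with ,-injective e1 | ,-injective e2
... | refl , refl | refl , refl with ≤-antisym l1 l2
... | refl = here refl
vertex-interval x y (E ∷ p) (here e1) (there h2) l1 l2 with ,-injective e1
... | refl , refl = ⊥-elim (<⇒≱ (proj₁ (vertex-lower (suc x) y p h2)) ≤-refl)
vertex-interval x y (E ∷ p) (there h1) (here e2) l1 l2 with ,-injective e2
... | refl , refl = ⊥-elim (<⇒≱ (proj₁ (vertex-lower (suc x) y p h1)) ≤-refl)
vertex-interval x y (E ∷ p) (there h1) (there h2) l1 l2 = there (vertex-interval (suc x) y p h1 h2 l1 l2)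

vertex-below-east : ∀ x y p {a b h} → (a , b) ∈ verticesFrom x y p → (a , h) ∈ eastStepsFrom x y p → b ≤ h
vertex-below-east x y (N ∷ p) (here e) he with ,-injective e
... | refl , refl = <⇒≤ (proj₂ (east-lower x (suc y) p he))
vertex-below-east x y (N ∷ p) (there hv) he = vertex-below-east x (suc y) p hv he
vertex-below-east x y (E ∷ p) (here e) (here e') with ,-injective e | ,-injective e'
... | refl , refl | refl , refl = ≤-refl
vertex-below-east x y (E ∷ p) (here e) (there he) with ,-injective e
... | refl , refl = ⊥-elim (<⇒≱ (proj₁ (east-lower (suc x) y p he)) ≤-refl)
vertex-below-east x y (E ∷ p) (there hv) (here e') with ,-injective e'
... | refl , refl = ⊥-elim (<⇒≱ (proj₁ (vertex-lower (suc x) y p hv)) ≤-refl)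
vertex-below-east x y (E ∷ p) (there hv) (there he) = vertex-below-east (suc x) y p hv he

vertex-above-east : ∀ x y p {a b h} → (suc a , b) ∈ verticesFrom x y p → (a , h) ∈ eastStepsFrom x y p → h ≤ b
vertex-above-east x y (N ∷ p) (here e) he with ,-injective e
... | refl , refl = ⊥-elim (<⇒≱ ≤-refl (proj₁ (east-lower (suc _) (suc y) p he)))
vertex-above-east x y (N ∷ p) (there hv) he = vertex-above-east x (suc y) p hv he
vertex-above-east x y (E ∷ p) (here e) he with ,-injective e
... | refl , refl = ⊥-elim (<⇒≱ ≤-refl (proj₁ (east-lower (suc _) y (E ∷ p) he)))
vertex-above-east x y (E ∷ p) (there hv) (here e') with ,-injective e'
... | refl , refl = proj₂ (vertex-lower (suc x) y p hv)
vertex-above-east x y (E ∷ p) (there hv) (there he) = vertex-above-east (suc x) y p hv he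

norths : ℕ → List NE
norths zero    = []
norths (suc j) = N ∷ norths j

eastStepsFrom-norths : ∀ x y j s → eastStepsFrom x y (norths j ++ s) ≡ eastStepsFrom x (y + j) s
eastStepsFrom-norths x y zero s    = cong (λ z → eastStepsFrom x z s) (sym (+-identityʳ y))
eastStepsFrom-norths x y (suc j) s =
  trans (eastStepsFrom-norths x (suc y) j s) (cong (λ z → eastStepsFrom x z s) (sym (+-suc y j)))

countE-norths : ∀ j s → countE (norths j ++ s) ≡ countE s
countE-norths zero    s = refl
countE-norths (suc j) s = countE-norths j s

countN-norths : ∀ j s → countN (norths j ++ s) ≡ j + countN s
countN-norths zero    s = refl
countN-norths (suc j) s = cong suc (countN-norths j s)

countE-only-norths : ∀ j → countE (norths j) ≡ 0
countE-only-norths zero    = refl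
countE-only-norths (suc j) = countE-only-norths j

countN-only-norths : ∀ j → countN (norths j) ≡ j
countN-only-norths zero    = refl
countN-only-norths (suc j) = cong suc (countN-only-norths j)

module PathFromHeights (n : ℕ) (h : ℕ → ℕ) (mono : ∀ a b → a ≤ b → h a ≤ h b) (bound : ∀ a → h a ≤ n) where

  pathFrom : ℕ → ℕ → ℕ → List NE
  pathFrom zero    x y = norths (n ∸ y)
  pathFrom (suc k) x y = norths (h x ∸ y) ++ (E ∷ pathFrom k (suc x) (h x))

  h-step : ∀ x → h x ≤ h (suc x)
  h-step x = mono x (suc x) (n≤1+n x)

  pathFrom-countE : ∀ k x y → countE (pathFrom k x y) ≡ k
  pathFrom-countE zero    x y = countE-only-norths (n ∸ y)
  pathFrom-countE (suc k) x y = trans (countE-norths (h x ∸ y) _) (cong suc (pathFrom-countE k (suc x) (h x)))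

  pathFrom-countN : ∀ k x y → y ≤ h x → countN (pathFrom k x y) ≡ n ∸ y
  pathFrom-countN zero    x y le = countN-only-norths (n ∸ y)
  pathFrom-countN (suc k) x y le = begin
    countN (pathFrom (suc k) x y)           ≡⟨ countN-norths (h x ∸ y) _ ⟩
    (h x ∸ y) + countN (pathFrom k (suc x) (h x)) ≡⟨ cong (h x ∸ y +_) (pathFrom-countN k (suc x) (h x) (h-step x)) ⟩
    (h x ∸ y) + (n ∸ h x)                   ≡⟨ +-comm (h x ∸ y) (n ∸ h x) ⟩
    (n ∸ h x) + (h x ∸ y)                   ≡⟨ [a∸b]+[b∸c]≡a∸c le (bound x) ⟩
    n ∸ y                                   ∎
    where open ≡-Reasoning

  eastSteps-pathFrom : ∀ k x y → y ≤ h x →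
    eastStepsFrom x y (pathFrom (suc k) x y) ≡ (x , h x) ∷ eastStepsFrom (suc x) (h x) (pathFrom k (suc x) (h x))
  eastSteps-pathFrom k x y le =
    trans (eastStepsFrom-norths x y (h x ∸ y) _)
          (cong (λ z → eastStepsFrom x z (E ∷ pathFrom k (suc x) (h x))) (m+[n∸m]≡n le))

  eastSteps-norths : ∀ x y j → eastStepsFrom x y (norths j) ≡ []
  eastSteps-norths x y zero    = refl
  eastSteps-norths x y (suc j) = eastSteps-norths x (suc y) j

  pathFrom-east⁻ : ∀ k x y → y ≤ h x → ∀ {a b} → (a , b) ∈ eastStepsFrom x y (pathFrom k x y) →
    x ≤ a × a < x + k × b ≡ h a
  pathFrom-east⁻ zero x y le hm rewrite eastSteps-norths x y (n ∸ y) with hm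
  ... | ()
  pathFrom-east⁻ (suc k) x y le {a} {b} hm rewrite eastSteps-pathFrom k x y le with hm
  ... | here e with ,-injective e
  ...   | refl , refl = ≤-refl , subst (x <_) (sym (+-suc x k)) (s≤s (m≤m+n x k)) , refl
  pathFrom-east⁻ (suc k) x y le {a} {b} hm | there hm' with pathFrom-east⁻ k (suc x) (h x) (h-step x) hm'
  ...   | l1 , l2 , l3 = <⇒≤ l1 , subst (a <_) (sym (+-suc x k)) l2 , l3

  pathFrom-east⁺ : ∀ k x y → y ≤ h x → ∀ a → x ≤ a → a < x + k → (a , h a) ∈ eastStepsFrom x y (pathFrom k x y)
  pathFrom-east⁺ zero x y le a l1 l2 = ⊥-elim (<⇒≱ l2 (subst (_≤ a) (sym (+-identityʳ x)) l1))
  pathFrom-east⁺ (suc k) x y le a l1 l2 rewrite eastSteps-pathFrom k x y le with x ≟ a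
  ... | yes refl = here refl
  ... | no ne = there (pathFrom-east⁺ k (suc x) (h x) (h-step x) a (≤∧≢⇒< l1 ne) (subst (a <_) (+-suc x k) l2))

  path : ℕ → List NE
  path m = pathFrom m 0 0

  path-east⁻ : ∀ m {a b} → (a , b) ∈ eastSteps (path m) → a < m × b ≡ h a
  path-east⁻ m hm with pathFrom-east⁻ m 0 0 z≤n hm
  ... | _ , l2 , l3 = l2 , l3

  path-east⁺ : ∀ m a → a < m → (a , h a) ∈ eastSteps (path m)
  path-east⁺ m a lt = pathFrom-east⁺ m 0 0 z≤n a z≤n lt

  path-isPath : ∀ m → IsPath m n (path m)
  path-isPath m = pathFrom-countE m 0 0 , pathFrom-countN m 0 0 z≤n

  path-startsN : ∀ m → 1 ≤ h 0 → Σ (List NE) λ P' → path (suc m) ≡ N ∷ P'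
  path-startsN m le with h 0
  ... | suc k = _ , refl

  path-startsE : ∀ m → h 0 ≡ 0 → Σ (List NE) λ P' → path (suc m) ≡ E ∷ P'
  path-startsE m e rewrite e = _ , refl

paths-meet-only-at-ends : ∀ m n U L (hu hl : ℕ → ℕ) → IsPath (suc m) n U → IsPath (suc m) n L →
  (∀ a → a < suc m → (a , hu a) ∈ eastSteps U) → (∀ a → a < suc m → (a , hl a) ∈ eastSteps L) →
  hl 0 ≡ 0 → hu m ≡ n → (∀ x → suc x < suc m → hl (suc x) < hu x) →
  ∀ p → p ∈ vertices U → p ∈ vertices L → p ≡ (0 , 0) ⊎ p ≡ (suc m , n)
paths-meet-only-at-ends m n U L hu hl _ _ eU eL hl0 hum sep (zero , b) vu vl
  with vertex-below-east 0 0 L vl (eL 0 (s≤s z≤n))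
... | le rewrite hl0 with le
... | z≤n = inj₁ refl
paths-meet-only-at-ends m n U L hu hl (ceU , cnU) _ eU eL hl0 hum sep (suc x , b) vu vl
  with vertex-upper 0 0 U vu | suc x <? suc m
... | a≤ , b≤ | yes lt =
  ⊥-elim (<⇒≱ (≤-<-trans (vertex-below-east 0 0 L vl (eL (suc x) lt)) (sep x lt))
              (vertex-above-east 0 0 U vu (eU x (<-trans (n<1+n x) lt))))
... | a≤ , b≤ | no ¬lt with ≤-antisym (subst (suc x ≤_) ceU a≤) (≮⇒≥ ¬lt)
... | refl = inj₂ (cong (suc m ,_) (≤-antisym (subst (b ≤_) cnU b≤)
                 (subst (_≤ b) hum (vertex-above-east 0 0 U vu (eU m ≤-refl)))))

module PathPair (m n : ℕ) (U L : List NE) (pp : IsPathPair m n U L) where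

  countE-U : countE U ≡ m
  countE-U = proj₁ (proj₁ pp)

  countE-L : countE L ≡ m
  countE-L = proj₁ (proj₁ (proj₂ pp))

  meet : ∀ p → p ∈ vertices U → p ∈ vertices L → p ≡ (0 , 0) ⊎ p ≡ (m , n)
  meet = proj₂ (proj₂ (proj₂ (proj₂ pp)))

  east-U : ∀ x → x < m → Σ ℕ λ h → (x , h) ∈ eastSteps U
  east-U x lt = east-exists 0 0 U x z≤n (subst (x <_) (sym countE-U) lt)

  east-L : ∀ x → x < m → Σ ℕ λ h → (x , h) ∈ eastSteps L
  east-L x lt = east-exists 0 0 L x z≤n (subst (x <_) (sym countE-L) lt)

  L-starts-east : (0 , 0) ∈ eastSteps L
  L-starts-east with proj₁ (proj₂ (proj₂ (proj₂ pp)))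
  ... | L' , refl = here refl

  U-starts-north : ∀ {h} → (0 , h) ∈ eastSteps U → 1 ≤ h
  U-starts-north {h} hm with proj₁ (proj₂ (proj₂ pp))
  ... | U' , refl = proj₂ (east-lower 0 1 U' hm)

  mutual
    lower<upper : ∀ x → x < m → ∀ {hl hu} → (x , hl) ∈ eastSteps L → (x , hu) ∈ eastSteps U → hl < hu
    lower<upper zero lt el eu with east-unique 0 0 L el L-starts-east
    ... | refl = U-starts-north eu
    lower<upper (suc x) lt el eu with east-U x (<-trans (n<1+n x) lt)
    ... | hu0 , eu0 = <-≤-trans (lower-next<upper x lt el eu0) (east-mono 0 0 U eu0 eu (n≤1+n x))

    -- otherwise the vertical segment of L in column x+1 would hit the corner of U
    lower-next<upper : ∀ x → suc x < m → ∀ {hl hu} → (suc x , hl) ∈ eastSteps L → (x , hu) ∈ eastSteps U → hl < hu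
    lower-next<upper x lt {hl} {hu} el eu with hl <? hu
    ... | yes p = p
    ... | no ¬p with east-L x (<-trans (n<1+n x) lt)
    ... | hlx , elx with meet (suc x , hu) (proj₂ (east-endpoints 0 0 U eu)) corner-on-L
      where
      corner-on-L : (suc x , hu) ∈ vertices L
      corner-on-L = vertex-interval 0 0 L (proj₂ (east-endpoints 0 0 L elx)) (proj₁ (east-endpoints 0 0 L el))
                      (<⇒≤ (lower<upper x (<-trans (n<1+n x) lt) elx eu)) (≮⇒≥ ¬p)
    ... | inj₁ e with () ← ,-injective e
    ... | inj₂ e = ⊥-elim (<⇒≢ lt (proj₁ (,-injective e)))

opposite : Bool → Bool → Bool
opposite true  false = true
opposite false true  = true
opposite _     _     = false

opposite-same : ∀ b → opposite b b ≡ false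
opposite-same true  = refl
opposite-same false = refl

opposite-diff : ∀ a b → a ≢ b → opposite a b ≡ true
opposite-diff true  true  h = ⊥-elim (h refl)
opposite-diff true  false h = refl
opposite-diff false true  h = refl
opposite-diff false false h = ⊥-elim (h refl)

sideOf-suc : ∀ k → sideOf (suc k) ≡ not (sideOf k)
sideOf-suc zero          = refl
sideOf-suc (suc zero)    = refl
sideOf-suc (suc (suc k)) = sideOf-suc k

settle : ℕ → ℕ → ℕ
settle d h = if ⌊ d ≤? h ⌋ then h ∸ d else h

settle-≥ : ∀ {d h} → d ≤ h → settle d h ≡ h ∸ d
settle-≥ {d} {h} le with d ≤? h
... | yes _ = refl
... | no ¬p = ⊥-elim (¬p le)

module Sandpile (t n : ℕ) where

  m : ℕ
  m = suc t

  Vertex : Set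
  Vertex = NonSink m n

  Cfg : Set
  Cfg = Config m n

  top : Fin t → Vertex
  top i = i ↑ˡ n

  bottom : Fin n → Vertex
  bottom j = t ↑ʳ j

  top? : Vertex → Bool
  top? = isTop m n

  isTop-top : ∀ i → top? (top i) ≡ true
  isTop-top i rewrite splitAt-↑ˡ t i n = refl

  isTop-bottom : ∀ j → top? (bottom j) ≡ false
  isTop-bottom j rewrite splitAt-↑ʳ t n j = refl

  data View : Vertex → Set where
    vtop : (i : Fin t) → View (top i)
    vbot : (j : Fin n) → View (bottom j)

  view : ∀ v → View v
  view v with splitAt t v in eq
  ... | inj₁ i = subst View (splitAt⁻¹-↑ˡ eq) (vtop i)
  ... | inj₂ j = subst View (splitAt⁻¹-↑ʳ eq) (vbot j)

  degree : Vertex → ℕ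
  degree = deg m n

  degree-top : ∀ i → degree (top i) ≡ n
  degree-top i rewrite isTop-top i = refl

  degree-bottom : ∀ j → degree (bottom j) ≡ m
  degree-bottom j rewrite isTop-bottom j = refl

  arc≡opposite : ∀ v w → arc m n v w ≡ opposite (top? v) (top? w)
  arc≡opposite v w with isTop m n v | isTop m n w
  ... | true  | true  = refl
  ... | true  | false = refl
  ... | false | true  = refl
  ... | false | false = refl

  fire : Cfg → Vertex → Cfg
  fire = topple m n

  fire-self : ∀ c v → fire c v v ≡ c v ∸ degree v
  fire-self c v with v ≟F v
  ... | yes _ = refl
  ... | no ¬p = ⊥-elim (¬p refl)

  fire-same-side : ∀ c v w → w ≢ v → top? w ≡ top? v → fire c v w ≡ c w
  fire-same-side c v w ne s with w ≟F v
  ... | yes e = ⊥-elim (ne e)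
  ... | no _ rewrite arc≡opposite v w | s | opposite-same (top? v) = refl

  fire-other-side : ∀ c v w → top? w ≢ top? v → fire c v w ≡ suc (c w)
  fire-other-side c v w d with w ≟F v
  ... | yes refl = ⊥-elim (d refl)
  ... | no _ rewrite arc≡opposite v w | opposite-diff (top? v) (top? w) (λ e → d (sym e)) = refl

  fire-≥ : ∀ c v w → w ≢ v → c w ≤ fire c v w
  fire-≥ c v w ne with top? w ≟𝔹 top? v
  ... | yes se = ≤-reflexive (sym (fire-same-side c v w ne se))
  ... | no sd  = subst (c w ≤_) (sym (fire-other-side c v w sd)) (n≤1+n (c w))

  _≐_ : Cfg → Cfg → Set
  c ≐ c' = ∀ w → c w ≡ c' w

  fire-resp : ∀ c c' v → c ≐ c' → fire c v ≐ fire c' v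
  fire-resp c c' v h w with w ≟F v
  ... | yes refl = cong (_∸ degree w) (h w)
  ... | no _ with arc m n v w
  ... | true  = cong suc (h w)
  ... | false = h w

  fireAll : Cfg → List Vertex → Cfg
  fireAll = foldl fire

  fireAll-resp : ∀ c c' vs → c ≐ c' → fireAll c vs ≐ fireAll c' vs
  fireAll-resp c c' []       h = h
  fireAll-resp c c' (v ∷ vs) h = fireAll-resp (fire c v) (fire c' v) vs (fire-resp c c' v h)

  fireAll-++ : ∀ c xs ys → fireAll c (xs ++ ys) ≐ fireAll (fireAll c xs) ys
  fireAll-++ c xs ys w = cong (λ z → z w) (foldl-++ fire c xs ys)

  Legal : Cfg → List Vertex → Set
  Legal c []       = ⊤
  Legal c (v ∷ vs) = degree v ≤ c v × Legal (fire c v) vs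

  legal-resp : ∀ c c' vs → c ≐ c' → Legal c vs → Legal c' vs
  legal-resp c c' []       h l       = tt
  legal-resp c c' (v ∷ vs) h (u , l) =
    subst (degree v ≤_) (h v) u , legal-resp (fire c v) (fire c' v) vs (fire-resp c c' v h) l

  legal⇒star : ∀ c vs → Legal c vs → Star (Step m n) c (fireAll c vs)
  legal⇒star c []       l       = ε
  legal⇒star c (v ∷ vs) (u , l) = (v , u , λ w → refl) ◅ legal⇒star (fire c v) vs l

  legal-++ : ∀ c xs ys → Legal c xs → Legal (fireAll c xs) ys → Legal c (xs ++ ys)
  legal-++ c []       ys l1       l2 = l2
  legal-++ c (x ∷ xs) ys (u , l1) l2 = u , legal-++ (fire c x) xs ys l1 l2

  _⊕_ : Cfg → Cfg → Cfg
  (c ⊕ e) w = c w + e w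

  fire-⊕ : ∀ c e v → degree v ≤ c v → fire (c ⊕ e) v ≐ (fire c v ⊕ e)
  fire-⊕ c e v le w with w ≟F v
  ... | yes refl = +-∸-comm (e w) le
  ... | no _ with arc m n v w
  ... | true  = refl
  ... | false = refl

  legal-⊕ : ∀ c e vs → Legal c vs → Legal (c ⊕ e) vs × (fireAll (c ⊕ e) vs ≐ (fireAll c vs ⊕ e))
  legal-⊕ c e []       l       = tt , λ w → refl
  legal-⊕ c e (v ∷ vs) (u , l) with legal-⊕ (fire c v) e vs l
  ... | l' , f' =
    (≤-trans u (m≤m+n (c v) (e v)) ,
     legal-resp (fire c v ⊕ e) (fire (c ⊕ e) v) vs (λ w → sym (fire-⊕ c e v u w)) l') ,
    λ w → trans (fireAll-resp (fire (c ⊕ e) v) (fire c v ⊕ e) vs (fire-⊕ c e v u) w) (f' w)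

  module Round (s : Bool) where

    stays-unstable : ∀ c v S → All (v ≢_) S → top? v ≡ s → All (λ x → top? x ≡ s) S →
      All (λ x → degree x ≤ c x) S → All (λ x → degree x ≤ fire c v x) S
    stays-unstable c v [] _ _ _ _ = []
    stays-unstable c v (x ∷ S) (ne ∷ nes) sv (sx ∷ sxs) (ux ∷ uxs) =
      subst (degree x ≤_) (sym (fire-same-side c v x (λ e → ne (sym e)) (trans sx (sym sv)))) ux ∷
      stays-unstable c v S nes sv sxs uxs

    round-legal : ∀ c S → Unique S → All (λ x → top? x ≡ s) S → All (λ x → degree x ≤ c x) S → Legal c S
    round-legal c []      _          _          _          = tt
    round-legal c (v ∷ S) (nes ∷ un) (sv ∷ ss) (uv ∷ us) =
      uv , round-legal (fire c v) S un ss (stays-unstable c v S nes sv ss us)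

    round-untouched : ∀ c S → Unique S → All (λ x → top? x ≡ s) S →
      ∀ w → w ∉ S → top? w ≡ s → fireAll c S w ≡ c w
    round-untouched c []      _          _         w _  _  = refl
    round-untouched c (v ∷ S) (nes ∷ un) (sv ∷ ss) w w∉ sw =
      trans (round-untouched (fire c v) S un ss w (λ h → w∉ (there h)) sw)
            (fire-same-side c v w (λ e → w∉ (here e)) (trans sw (sym sv)))

    round-fired : ∀ c S → Unique S → All (λ x → top? x ≡ s) S → ∀ w → w ∈ S → fireAll c S w ≡ c w ∸ degree w
    round-fired c (v ∷ S) (nes ∷ un) (sv ∷ ss) w (here refl) =
      trans (round-untouched (fire c v) S un ss w (λ h → All.lookup nes h refl) sv) (fire-self c w)
    round-fired c (v ∷ S) (nes ∷ un) (sv ∷ ss) w (there w∈) =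
      trans (round-fired (fire c v) S un ss w w∈)
        (cong (_∸ degree w)
          (fire-same-side c v w (λ e → All.lookup nes w∈ (sym e)) (trans (All.lookup ss w∈) (sym sv))))

    round-other-side : ∀ c S → All (λ x → top? x ≡ s) S → ∀ w → top? w ≢ s → fireAll c S w ≡ c w + length S
    round-other-side c []      _         w _  = sym (+-identityʳ (c w))
    round-other-side c (v ∷ S) (sv ∷ ss) w sw =
      trans (round-other-side (fire c v) S ss w sw)
        (trans (cong (_+ length S) (fire-other-side c v w (λ e → sw (trans e sv))))
               (sym (+-suc (c w) (length S))))

  count-vertices : (p : Vertex → Bool) →
    count p (allFin (t + n)) ≡ count (p ∘ top) (allFin t) + count (p ∘ bottom) (allFin n)
  count-vertices p = trans (cong (count p) (tabulate-+ t n (λ v → v)))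
    (trans (count-++ p (tabulate top) (tabulate bottom)) (cong₂ _+_ (count-tabulate p top) (count-tabulate p bottom)))

  onSide : Bool → (Vertex → Bool) → Vertex → Bool
  onSide s q v = ⌊ top? v ≟𝔹 s ⌋ ∧ q v

  count-tops : (q : Vertex → Bool) → count (onSide true q) (allFin (t + n)) ≡ count (q ∘ top) (allFin t)
  count-tops q = trans (count-vertices (onSide true q))
    (trans (cong₂ _+_ (count-cong _ _ (allFin t) (λ i _ → on-top i)) (count-none _ (allFin n) (λ j _ → off-bottom j)))
           (+-identityʳ _))
    where
    on-top : ∀ i → onSide true q (top i) ≡ q (top i)
    on-top i rewrite isTop-top i = refl
    off-bottom : ∀ j → onSide true q (bottom j) ≡ false
    off-bottom j rewrite isTop-bottom j = refl

  count-bottoms : (q : Vertex → Bool) → count (onSide false q) (allFin (t + n)) ≡ count (q ∘ bottom) (allFin n)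
  count-bottoms q = trans (count-vertices (onSide false q))
    (cong₂ _+_ (count-none _ (allFin t) (λ i _ → off-top i)) (count-cong _ _ (allFin n) (λ j _ → on-bottom j)))
    where
    off-top : ∀ i → onSide false q (top i) ≡ false
    off-top i rewrite isTop-top i = refl
    on-bottom : ∀ j → onSide false q (bottom j) ≡ q (bottom j)
    on-bottom j rewrite isTop-bottom j = refl

  onSide-true⁻ : ∀ s q v → onSide s q v ≡ true → top? v ≡ s × q v ≡ true
  onSide-true⁻ s q v h with ∧-elim {⌊ top? v ≟𝔹 s ⌋} h
  ... | a , b = isYes⇒ (top? v ≟𝔹 s) a , b

  unstable : Bool → Cfg → List Vertex
  unstable s c = unstableOn m n s c

  isUnstable-true : ∀ c v → degree v ≤ c v → isUnstableᵇ m n c v ≡ true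
  isUnstable-true c v u = ⇒isYes (degree v ≤? c v) u

  ∈-unstable⁺ : ∀ s c v → top? v ≡ s → degree v ≤ c v → v ∈ unstable s c
  ∈-unstable⁺ s c v e u = ∈-filterᵇ⁺ (onSide s (isUnstableᵇ m n c)) (∈-allFin v)
    (∧-intro (⇒isYes (top? v ≟𝔹 s) e) (isUnstable-true c v u))

  ∈-unstable⁻ : ∀ s c v → v ∈ unstable s c → top? v ≡ s × degree v ≤ c v
  ∈-unstable⁻ s c v h with onSide-true⁻ s (isUnstableᵇ m n c) v
                              (proj₂ (∈-filterᵇ⁻ (onSide s (isUnstableᵇ m n c)) {xs = allFin (t + n)} h))
  ... | a , b = a , isYes⇒ (degree v ≤? c v) b

  length-unstable-top : ∀ c → length (unstable true c) ≡ count (isUnstableᵇ m n c ∘ top) (allFin t)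
  length-unstable-top c = trans (length-filterᵇ _ (allFin (t + n))) (count-tops (isUnstableᵇ m n c))

  length-unstable-bottom : ∀ c → length (unstable false c) ≡ count (isUnstableᵇ m n c ∘ bottom) (allFin n)
  length-unstable-bottom c = trans (length-filterᵇ _ (allFin (t + n))) (count-bottoms (isUnstableᵇ m n c))

  round : ∀ s c → Legal c (unstable s c) ×
     (∀ w → top? w ≡ s → fireAll c (unstable s c) w ≡ settle (degree w) (c w)) ×
     (∀ w → top? w ≢ s → fireAll c (unstable s c) w ≡ c w + length (unstable s c))
  round s c = R.round-legal c S distinct sides unstables , settles , λ w ne → R.round-other-side c S sides w ne
    where
    module R = Round s
    S : List Vertex
    S = unstable s c
    distinct : Unique S
    distinct = Unique-filterᵇ _ (allFin⁺ (t + n))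
    sides : All (λ x → top? x ≡ s) S
    sides = All-from-∈ (λ x x∈ → proj₁ (∈-unstable⁻ s c x x∈))
    unstables : All (λ x → degree x ≤ c x) S
    unstables = All-from-∈ (λ x x∈ → proj₂ (∈-unstable⁻ s c x x∈))
    settles : ∀ w → top? w ≡ s → fireAll c S w ≡ settle (degree w) (c w)
    settles w e with degree w ≤? c w
    ... | yes u = R.round-fired c S distinct sides w (∈-unstable⁺ s c w e u)
    ... | no nu = R.round-untouched c S distinct sides w (λ h → nu (proj₂ (∈-unstable⁻ s c w h))) e

  open import Data.List.Membership.DecPropositional (_≟F_ {t + n}) using (_∈?_)

  toppled : ∀ {a b} → Star (Step m n) a b → List Vertex
  toppled ε                 = []
  toppled ((v , _ , _) ◅ d) = v ∷ toppled d

  remove : Vertex → List Vertex → List Vertex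
  remove s = filterᵇ (λ w → not ⌊ w ≟F s ⌋)

  remove-absent : ∀ s S → All (s ≢_) S → remove s S ≡ S
  remove-absent s []      _          = refl
  remove-absent s (w ∷ S) (ne ∷ nes) with w ≟F s
  ... | yes e = ⊥-elim (ne (sym e))
  ... | no _  = cong (w ∷_) (remove-absent s S nes)

  remove-length : ∀ s S → Unique S → s ∈ S → suc (length (remove s S)) ≡ length S
  remove-length s (w ∷ S) (nes ∷ un) (here refl) with w ≟F w
  ... | yes _ = cong suc (cong length (remove-absent w S nes))
  ... | no ¬e = ⊥-elim (¬e refl)
  remove-length s (w ∷ S) (nes ∷ un) (there h) with w ≟F s
  ... | yes refl = ⊥-elim (All.lookup nes h refl)
  ... | no _     = cong suc (remove-length s S un h)

  ∈-remove⁻ : ∀ s S w → w ∈ remove s S → w ∈ S × w ≢ s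
  ∈-remove⁻ s S w h with ∈-filterᵇ⁻ (λ w → not ⌊ w ≟F s ⌋) h
  ... | w∈ , _ with w ≟F s
  ... | no ne = w∈ , ne

  all-∈? : ∀ (W l : List Vertex) → All (_∈ l) W ⊎ (Σ Vertex λ w → w ∈ W × w ∉ l)
  all-∈? []      l = inj₁ []
  all-∈? (w ∷ W) l with w ∈? l | all-∈? W l
  ... | no ¬p | _                  = inj₂ (w , here refl , ¬p)
  ... | yes p | inj₁ a             = inj₁ (p ∷ a)
  ... | yes p | inj₂ (w' , h , nh) = inj₂ (w' , there h , nh)

  grains-received : ∀ {a b} (d : Star (Step m n) a b) v → v ∉ toppled d → ∀ S → Unique S →
    All (λ s → top? s ≢ top? v) S → All (_∈ toppled d) S → a v + length S ≤ b v
  grains-received ε v _ []      _ _ _        = ≤-reflexive (+-identityʳ _)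
  grains-received ε v _ (s ∷ S) _ _ (() ∷ _)
  grains-received {a} {b} ((s , _ , eq) ◅ d) v v∉ S un sides ins with s ∈? S
  ... | yes s∈ =
    subst (_≤ b v) (trans (cong (_+ length S') (trans (eq v) (fire-other-side a s v (λ e → All.lookup sides s∈ (sym e)))))
                   (trans (sym (+-suc (a v) (length S'))) (cong (a v +_) (remove-length s S un s∈))))
      (grains-received d v (λ h → v∉ (there h)) S' (Unique-filterᵇ _ un)
        (All-from-∈ (λ w w∈ → All.lookup sides (proj₁ (∈-remove⁻ s S w w∈))))
        (All-from-∈ (λ w w∈ → let (w∈S , ne) = ∈-remove⁻ s S w w∈ in ∈-tail (All.lookup ins w∈S) ne)))
    where
    S' : List Vertex
    S' = remove s S
  ... | no s∉ =
    ≤-trans (+-monoˡ-≤ (length S) (subst (a v ≤_) (sym (eq v)) (fire-≥ a s v (λ e → v∉ (here e)))))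
      (grains-received d v (λ h → v∉ (there h)) S un sides
        (All-from-∈ (λ w w∈ → ∈-tail (All.lookup ins w∈) (λ e → s∉ (subst (_∈ S) e w∈)))))

  last-toppling-bound : ∀ {a b} (d : Star (Step m n) a b) w → w ∉ toppled d → (side : Bool) → top? w ≡ side →
    ∀ S → Unique S → All (λ x → top? x ≡ not side) S → All (_∈ w ∷ toppled d) S → length S ≤ b w
  last-toppling-bound d w w∉ side sw S uS sS inS =
    ≤-trans (m≤n+m (length S) _) (grains-received d w w∉ S uS other (All-from-∈ later))
    where
    other : All (λ x → top? x ≢ top? w) S
    other = All.map (λ sx e → not-¬ sw (trans (sym e) sx)) sS
    later : ∀ x → x ∈ S → x ∈ toppled d
    later x x∈ = ∈-tail (All.lookup inS x∈) (λ e → All.lookup other x∈ (cong top? e))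

  -- A nonempty set WT of top vertices and a set WB of bottom vertices that all
  -- topple along d: at the end, some vertex of WT holds at least |WB| grains or
  -- some vertex of WB holds at least |WT| grains (look at the first vertex of
  -- WT ∪ WB to topple for the last time).
  forbidden : ∀ {a b} (d : Star (Step m n) a b) (WT WB : List Vertex) → Unique WT → Unique WB →
    All (λ w → top? w ≡ true) WT → All (λ w → top? w ≡ false) WB →
    All (_∈ toppled d) WT → All (_∈ toppled d) WB → (Σ Vertex λ w → w ∈ WT) →
    (Σ Vertex λ w → w ∈ WT × length WB ≤ b w) ⊎ (Σ Vertex λ w → w ∈ WB × length WT ≤ b w)
  forbidden ε WT WB _ _ _ _ inT _ (w , w∈) with () ← All.lookup inT w∈
  forbidden ((s , _ , _) ◅ d) WT WB uT uB sT sB inT inB ne with all-∈? WT (toppled d) | all-∈? WB (toppled d)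
  ... | inj₁ aT | inj₁ aB = forbidden d WT WB uT uB sT sB aT aB ne
  ... | inj₂ (w , w∈ , w∉) | _ with All.lookup inT w∈
  ...   | there h   = ⊥-elim (w∉ h)
  ...   | here refl = inj₁ (w , w∈ , last-toppling-bound d w w∉ true (All.lookup sT w∈) WB uB sB inB)
  forbidden ((s , _ , _) ◅ d) WT WB uT uB sT sB inT inB ne | inj₁ _ | inj₂ (w , w∈ , w∉) with All.lookup inB w∈
  ...   | there h   = ⊥-elim (w∉ h)
  ...   | here refl = inj₂ (w , w∈ , last-toppling-bound d w w∉ false (All.lookup sB w∈) WT uT sT inT)

module Heights (t n : ℕ) (u : Config (suc t) n) (stable : IsStable (suc t) n u) where
  open Sandpile t n

  topH : Fin t → ℕ
  topH i = u (top i)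

  botH : Fin n → ℕ
  botH j = u (bottom j)

  module TA = Threshold topH
  module TB = Threshold botH

  A : ℕ → ℕ
  A Y = count (below Y) (topHeights m n u)

  B : ℕ → ℕ
  B X = count (below X) (botHeights m n u)

  A-count : ∀ Y → A Y ≡ TA.countBelow Y (allFin t)
  A-count Y = count-tabulate (below Y) topH

  B-count : ∀ X → B X ≡ TB.countBelow X (allFin n)
  B-count X = count-tabulate (below X) botH

  topH<n : ∀ i → topH i < n
  topH<n i = subst (u (top i) <_) (degree-top i) (stable (top i))

  botH<m : ∀ j → botH j < m
  botH<m j = subst (u (bottom j) <_) (degree-bottom j) (stable (bottom j))

  A-mono : ∀ {Y Y'} → Y ≤ Y' → A Y ≤ A Y'
  A-mono {Y} {Y'} le = subst₂ _≤_ (sym (A-count Y)) (sym (A-count Y')) (TA.countBelow-mono (allFin t) le)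

  B-mono : ∀ {X X'} → X ≤ X' → B X ≤ B X'
  B-mono {X} {X'} le = subst₂ _≤_ (sym (B-count X)) (sym (B-count X')) (TB.countBelow-mono (allFin n) le)

  A≤t : ∀ Y → A Y ≤ t
  A≤t Y = subst (A Y ≤_) (length-tabulate topH) (count≤length (below Y) (topHeights m n u))

  B≤n : ∀ X → B X ≤ n
  B≤n X = subst (B X ≤_) (length-tabulate botH) (count≤length (below X) (botHeights m n u))

  A<m : ∀ Y → A Y < m
  A<m Y = s≤s (A≤t Y)

  A0 : A 0 ≡ 0
  A0 = count-none (below 0) (topHeights m n u) (λ x _ → below-false {0} {x} λ ())

  B0 : B 0 ≡ 0
  B0 = count-none (below 0) (botHeights m n u) (λ x _ → below-false {0} {x} λ ())

  -- by stability every top height is < n and every bottom height is < m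
  An : A n ≡ t
  An = trans (A-count n) (trans (count-all _ (allFin t) (λ i _ → below-true (topH<n i))) (length-tabulate (λ i → i)))

  Bm : B m ≡ n
  Bm = trans (B-count m) (trans (count-all _ (allFin n) (λ j _ → below-true (botH<m j))) (length-tabulate (λ j → j)))

  -- In conf X Y the top vertices of height ≥ Y and
  -- the bottom vertices of height ≥ X have toppled once, while every vertex has
  -- received one grain from each toppled vertex of the other side (and the
  -- bottoms the initial extra grain).

  confTop : ℕ → ℕ → ℕ → ℕ
  confTop X Y h = if ⌊ Y ≤? h ⌋ then h ∸ B X else h + (n ∸ B X)

  confBot : ℕ → ℕ → ℕ → ℕ
  confBot X Y h = if ⌊ X ≤? h ⌋ then h ∸ A Y else suc h + (t ∸ A Y)

  conf : ℕ → ℕ → Cfg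
  conf X Y v = if top? v then confTop X Y (u v) else confBot X Y (u v)

  conf-top : ∀ X Y i → conf X Y (top i) ≡ confTop X Y (topH i)
  conf-top X Y i rewrite isTop-top i = refl

  conf-bottom : ∀ X Y j → conf X Y (bottom j) ≡ confBot X Y (botH j)
  conf-bottom X Y j rewrite isTop-bottom j = refl

  Inv : ℕ → ℕ → Set
  Inv X Y = A Y ≤ X × B X ≤ Y

  confTop-unstable⁻ : ∀ X Y p → p < n → n ≤ confTop X Y p → p < Y × B X ≤ p
  confTop-unstable⁻ X Y p pn h with Y ≤? p
  ... | yes _ = ⊥-elim (<⇒≱ (a∸b<M p (B X) pn) h)
  ... | no ¬q = ≰⇒> ¬q , M≤a+[M∸b]⇒b≤a (B≤n X) h

  confTop-unstable⁺ : ∀ X Y p → p < Y → B X ≤ p → n ≤ confTop X Y p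
  confTop-unstable⁺ X Y p a b with Y ≤? p
  ... | yes q = ⊥-elim (<⇒≱ a q)
  ... | no _  = b≤a⇒M≤a+[M∸b] b (B≤n X)

  confBot-unstable⁻ : ∀ X Y q → q < m → m ≤ confBot X Y q → q < X × A Y ≤ q
  confBot-unstable⁻ X Y q qm h with X ≤? q
  ... | yes _ = ⊥-elim (<⇒≱ (a∸b<M q (A Y) qm) h)
  ... | no ¬q = ≰⇒> ¬q , s≤s⁻¹ (M≤a+[M∸b]⇒b≤a {suc q} {suc (A Y)} {suc t} (s≤s (A≤t Y)) h)

  confBot-unstable⁺ : ∀ X Y q → q < X → A Y ≤ q → m ≤ confBot X Y q
  confBot-unstable⁺ X Y q a b with X ≤? q
  ... | yes r = ⊥-elim (<⇒≱ a r)
  ... | no _  = b≤a⇒M≤a+[M∸b] {suc q} {suc (A Y)} {suc t} (s≤s b) (s≤s (A≤t Y))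

  isUnstable-top : ∀ X Y c → c ≐ conf X Y → ∀ i →
    isUnstableᵇ m n c (top i) ≡ below Y (topH i) ∧ not (below (B X) (topH i))
  isUnstable-top X Y c ce i = Bool-ext to from
    where
    c≡ : c (top i) ≡ confTop X Y (topH i)
    c≡ = trans (ce (top i)) (conf-top X Y i)
    to : isUnstableᵇ m n c (top i) ≡ true → below Y (topH i) ∧ not (below (B X) (topH i)) ≡ true
    to h with confTop-unstable⁻ X Y (topH i) (topH<n i)
                (subst₂ _≤_ (degree-top i) c≡ (isYes⇒ (degree (top i) ≤? c (top i)) h))
    ... | a , b = ∧-intro (below-true a) (not-false (below-false {B X} {topH i} (≤⇒≯ b)))
    from : below Y (topH i) ∧ not (below (B X) (topH i)) ≡ true → isUnstableᵇ m n c (top i) ≡ true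
    from h with ∧-elim {below Y (topH i)} h
    ... | a , b = isUnstable-true c (top i) (subst₂ _≤_ (sym (degree-top i)) (sym c≡)
                    (confTop-unstable⁺ X Y (topH i) (below-true⁻ a) (below-false⁻ b)))

  isUnstable-bottom : ∀ X Y c → c ≐ conf X Y → ∀ j →
    isUnstableᵇ m n c (bottom j) ≡ below X (botH j) ∧ not (below (A Y) (botH j))
  isUnstable-bottom X Y c ce j = Bool-ext to from
    where
    c≡ : c (bottom j) ≡ confBot X Y (botH j)
    c≡ = trans (ce (bottom j)) (conf-bottom X Y j)
    to : isUnstableᵇ m n c (bottom j) ≡ true → below X (botH j) ∧ not (below (A Y) (botH j)) ≡ true
    to h with confBot-unstable⁻ X Y (botH j) (botH<m j)
                (subst₂ _≤_ (degree-bottom j) c≡ (isYes⇒ (degree (bottom j) ≤? c (bottom j)) h))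
    ... | a , b = ∧-intro (below-true a) (not-false (below-false {A Y} {botH j} (≤⇒≯ b)))
    from : below X (botH j) ∧ not (below (A Y) (botH j)) ≡ true → isUnstableᵇ m n c (bottom j) ≡ true
    from h with ∧-elim {below X (botH j)} h
    ... | a , b = isUnstable-true c (bottom j) (subst₂ _≤_ (sym (degree-bottom j)) (sym c≡)
                    (confBot-unstable⁺ X Y (botH j) (below-true⁻ a) (below-false⁻ b)))

  size-top-round : ∀ X Y → B X ≤ Y → ∀ c → c ≐ conf X Y → length (unstable true c) ≡ A Y ∸ A (B X)
  size-top-round X Y bx c ce =
    trans (length-unstable-top c)
      (trans (count-cong _ _ (allFin t) (λ i _ → isUnstable-top X Y c ce i))
        (trans (TA.countBelow-diff (allFin t) bx) (sym (cong₂ _∸_ (A-count Y) (A-count (B X))))))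

  size-bottom-round : ∀ X Y → A Y ≤ X → ∀ c → c ≐ conf X Y → length (unstable false c) ≡ B X ∸ B (A Y)
  size-bottom-round X Y ay c ce =
    trans (length-unstable-bottom c)
      (trans (count-cong _ _ (allFin n) (λ j _ → isUnstable-bottom X Y c ce j))
        (trans (TB.countBelow-diff (allFin n) ay) (sym (cong₂ _∸_ (B-count X) (B-count (A Y))))))

  confTop-gain : ∀ X X' Y → B X' ≤ B X → B X ≤ Y → ∀ p → confTop X Y p + (B X ∸ B X') ≡ confTop X' Y p
  confTop-gain X X' Y le bx p with Y ≤? p
  ... | yes yp = [a∸b]+[b∸c]≡a∸c le (≤-trans bx yp)
  ... | no _   = trans (+-assoc p (n ∸ B X) _) (cong (p +_) ([a∸b]+[b∸c]≡a∸c le (B≤n X)))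

  confBot-gain : ∀ X Y Y' → A Y' ≤ A Y → A Y ≤ X → ∀ q → confBot X Y q + (A Y ∸ A Y') ≡ confBot X Y' q
  confBot-gain X Y Y' le ay q with X ≤? q
  ... | yes xq = [a∸b]+[b∸c]≡a∸c le (≤-trans ay xq)
  ... | no _   = trans (+-assoc (suc q) (t ∸ A Y) _) (cong (suc q +_) ([a∸b]+[b∸c]≡a∸c le (A≤t Y)))

  confTop-settle : ∀ X Y p → B X ≤ Y → p < n → settle n (confTop X Y p) ≡ confTop X (B X) p
  confTop-settle X Y p bx pn with n ≤? confTop X Y p
  ... | yes unst = fired (confTop-unstable⁻ X Y p pn unst)
    where
    fired : p < Y × B X ≤ p → confTop X Y p ∸ n ≡ confTop X (B X) p
    fired (a , b) with Y ≤? p | B X ≤? p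
    ... | yes c | _     = ⊥-elim (<⇒≱ a c)
    ... | no _  | no d  = ⊥-elim (d b)
    ... | no _  | yes _ = [a+[M∸b]]∸M≡a∸b b (B≤n X)
  ... | no st = kept (λ (a , b) → st (confTop-unstable⁺ X Y p a b))
    where
    kept : ¬ (p < Y × B X ≤ p) → confTop X Y p ≡ confTop X (B X) p
    kept stays with Y ≤? p | B X ≤? p
    ... | yes _ | yes _ = refl
    ... | yes c | no d  = ⊥-elim (d (≤-trans bx c))
    ... | no _  | no _  = refl
    ... | no c  | yes d = ⊥-elim (stays (≰⇒> c , d))

  confBot-settle : ∀ X Y q → A Y ≤ X → q < m → settle m (confBot X Y q) ≡ confBot (A Y) Y q
  confBot-settle X Y q ay qm with m ≤? confBot X Y q
  ... | yes unst = fired (confBot-unstable⁻ X Y q qm unst)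
    where
    fired : q < X × A Y ≤ q → confBot X Y q ∸ m ≡ confBot (A Y) Y q
    fired (a , b) with X ≤? q | A Y ≤? q
    ... | yes c | _     = ⊥-elim (<⇒≱ a c)
    ... | no _  | no d  = ⊥-elim (d b)
    ... | no _  | yes _ = [a+[M∸b]]∸M≡a∸b {suc q} {suc (A Y)} {suc t} (s≤s b) (s≤s (A≤t Y))
  ... | no st = kept (λ (a , b) → st (confBot-unstable⁺ X Y q a b))
    where
    kept : ¬ (q < X × A Y ≤ q) → confBot X Y q ≡ confBot (A Y) Y q
    kept stays with X ≤? q | A Y ≤? q
    ... | yes _ | yes _ = refl
    ... | yes c | no d  = ⊥-elim (d (≤-trans ay c))
    ... | no _  | no _  = refl
    ... | no c  | yes d = ⊥-elim (stays (≰⇒> c , d))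

  top-round : ∀ X Y → Inv X Y → ∀ c → c ≐ conf X Y → fireAll c (unstable true c) ≐ conf X (B X)
  top-round X Y (ay , bx) c ce w with view w | round true c
  ... | vbot j | _ , _ , gains = begin
    fireAll c (unstable true c) (bottom j)         ≡⟨ gains (bottom j) (not-¬ (isTop-bottom j)) ⟩
    c (bottom j) + length (unstable true c)        ≡⟨ cong₂ _+_ (trans (ce (bottom j)) (conf-bottom X Y j))
                                                               (size-top-round X Y bx c ce) ⟩
    confBot X Y (botH j) + (A Y ∸ A (B X))         ≡⟨ confBot-gain X Y (B X) (A-mono bx) ay (botH j) ⟩
    confBot X (B X) (botH j)                       ≡⟨ sym (conf-bottom X (B X) j) ⟩
    conf X (B X) (bottom j)                        ∎
    where open ≡-Reasoning
  ... | vtop i | _ , settles , _ = begin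
    fireAll c (unstable true c) (top i)            ≡⟨ settles (top i) (isTop-top i) ⟩
    settle (degree (top i)) (c (top i))            ≡⟨ cong₂ settle (degree-top i) (trans (ce (top i)) (conf-top X Y i)) ⟩
    settle n (confTop X Y (topH i))                ≡⟨ confTop-settle X Y (topH i) bx (topH<n i) ⟩
    confTop X (B X) (topH i)                       ≡⟨ sym (conf-top X (B X) i) ⟩
    conf X (B X) (top i)                           ∎
    where open ≡-Reasoning

  bottom-round : ∀ X Y → Inv X Y → ∀ c → c ≐ conf X Y → fireAll c (unstable false c) ≐ conf (A Y) Y
  bottom-round X Y (ay , bx) c ce w with view w | round false c
  ... | vtop i | _ , _ , gains = begin
    fireAll c (unstable false c) (top i)           ≡⟨ gains (top i) (not-¬ (isTop-top i)) ⟩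
    c (top i) + length (unstable false c)          ≡⟨ cong₂ _+_ (trans (ce (top i)) (conf-top X Y i))
                                                               (size-bottom-round X Y ay c ce) ⟩
    confTop X Y (topH i) + (B X ∸ B (A Y))         ≡⟨ confTop-gain X (A Y) Y (B-mono ay) bx (topH i) ⟩
    confTop (A Y) Y (topH i)                       ≡⟨ sym (conf-top (A Y) Y i) ⟩
    conf (A Y) Y (top i)                           ∎
    where open ≡-Reasoning
  ... | vbot j | _ , settles , _ = begin
    fireAll c (unstable false c) (bottom j)        ≡⟨ settles (bottom j) (isTop-bottom j) ⟩
    settle (degree (bottom j)) (c (bottom j))      ≡⟨ cong₂ settle (degree-bottom j) (trans (ce (bottom j)) (conf-bottom X Y j)) ⟩
    settle m (confBot X Y (botH j))                ≡⟨ confBot-settle X Y (botH j) ay (botH<m j) ⟩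
    confBot (A Y) Y (botH j)                       ≡⟨ sym (conf-bottom (A Y) Y j) ⟩
    conf (A Y) Y (bottom j)                        ∎
    where open ≡-Reasoning

  sT : List ℕ
  sT = sort (topHeights m n u)

  sB : List ℕ
  sB = sort (botHeights m n u)

  length-sT : length sT ≡ t
  length-sT = trans (↭-length (sort-↭ _)) (length-tabulate _)

  length-sB : length sB ≡ n
  length-sB = trans (↭-length (sort-↭ _)) (length-tabulate _)

  count-sT : ∀ y → count (below y) sT ≡ A y
  count-sT y = count-↭ (below y) (sort-↭ _)

  count-sB : ∀ x → count (below x) sB ≡ B x
  count-sB x = count-↭ (below x) (sort-↭ _)

  A≤⇔<sT : ∀ x y → x < t → (y < suc (nth sT x) → A y ≤ x) × (A y ≤ x → y < suc (nth sT x))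
  A≤⇔<sT x y xt =
    (λ h → subst (_≤ x) (count-sT y) (proj₁ sorted (s≤s⁻¹ h))) ,
    (λ h → s≤s (proj₂ sorted (subst (_≤ x) (sym (count-sT y)) h)))
    where
    sorted : (y ≤ nth sT x → count (below y) sT ≤ x) × (count (below y) sT ≤ x → y ≤ nth sT x)
    sorted = sorted-count≤⇔ sT (sort-↗ _) x (subst (x <_) (sym length-sT) xt) y

  B≤⇔<sB : ∀ x y → y < n → (x < suc (nth sB y) → B x ≤ y) × (B x ≤ y → x < suc (nth sB y))
  B≤⇔<sB x y yn =
    (λ h → subst (_≤ y) (count-sB x) (proj₁ sorted (s≤s⁻¹ h))) ,
    (λ h → s≤s (proj₂ sorted (subst (_≤ y) (sym (count-sB x)) h)))
    where
    sorted : (x ≤ nth sB y → count (below x) sB ≤ y) × (count (below x) sB ≤ y → x ≤ nth sB y)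
    sorted = sorted-count≤⇔ sB (sort-↗ _) y (subst (y <_) (sym length-sB) yn) x

  length-colHeights : length (colHeights m n u) ≡ m
  length-colHeights =
    trans (length-++ (map suc sT)) (trans (cong (_+ 1) (trans (length-map suc sT) length-sT)) (+-comm t 1))

  length-rowWidths : length (rowWidths m n u) ≡ n
  length-rowWidths = trans (length-map suc sB) length-sB

  colHeight-< : ∀ x → x < t → nth (colHeights m n u) x ≡ suc (nth sT x)
  colHeight-< x xt =
    trans (nth-++ˡ (map suc sT) _ x (subst (x <_) (sym (trans (length-map suc sT) length-sT)) xt))
          (nth-map-suc sT x (subst (x <_) (sym length-sT) xt))

  colHeight-last : nth (colHeights m n u) t ≡ n
  colHeight-last =
    trans (cong (nth (colHeights m n u)) (sym (trans (cong (_+ 0) (trans (length-map suc sT) length-sT)) (+-identityʳ t))))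
          (nth-++ʳ (map suc sT) (n ∷ []) 0)

  rowWidth : ∀ y → y < n → nth (rowWidths m n u) y ≡ suc (nth sB y)
  rowWidth y yn = nth-map-suc sB y (subst (y <_) (sym length-sB) yn)

  InF : ℕ → ℕ → Set
  InF x y = x < m × y < n × A y ≤ x × B x ≤ y

  f⇒InF : ∀ x y → f m n u x y → InF x y
  f⇒InF x y (col , row) with fromIndexed (colHeights m n u) x (y <_) col | fromIndexed (rowWidths m n u) y (x <_) row
  ... | xl , hy | yl , hx = xm , yn , ay , proj₁ (B≤⇔<sB x y yn) (subst (x <_) (rowWidth y yn) hx)
    where
    xm : x < m
    xm = subst (x <_) length-colHeights xl
    yn : y < n
    yn = subst (y <_) length-rowWidths yl
    ay : A y ≤ x
    ay with x <? t
    ... | yes xt = proj₁ (A≤⇔<sT x y xt) (subst (y <_) (colHeight-< x xt) hy)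
    ... | no ¬xt = ≤-trans (A≤t y) (≮⇒≥ ¬xt)

  InF⇒f : ∀ x y → InF x y → f m n u x y
  InF⇒f x y (xm , yn , ay , bx) =
    toIndexed (colHeights m n u) x (y <_) (subst (x <_) (sym length-colHeights) xm) hy ,
    toIndexed (rowWidths m n u) y (x <_) (subst (y <_) (sym length-rowWidths) yn)
      (subst (x <_) (sym (rowWidth y yn)) (proj₂ (B≤⇔<sB x y yn) bx))
    where
    hy : y < nth (colHeights m n u) x
    hy with x <? t
    ... | yes xt = subst (y <_) (sym (colHeight-< x xt)) (proj₂ (A≤⇔<sT x y xt) ay)
    ... | no ¬xt with ≤-antisym (s≤s⁻¹ xm) (≮⇒≥ ¬xt)
    ... | refl = subst (y <_) (sym colHeight-last) yn

  roundStep : Bool → ℕ × ℕ → ℕ × ℕ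
  roundStep false (X , Y) = (A Y , Y)
  roundStep true  (X , Y) = (X , B X)

  thresholds : ℕ → ℕ × ℕ
  thresholds zero    = (m , n)
  thresholds (suc k) = roundStep (sideOf k) (thresholds k)

  Xs Ys : ℕ → ℕ
  Xs k = proj₁ (thresholds k)
  Ys k = proj₂ (thresholds k)

  canonStart≐conf : canonStart m n u ≐ conf m n
  canonStart≐conf w with view w
  ... | vtop i rewrite isTop-top i with n ≤? topH i
  ... | yes le = ⊥-elim (<⇒≱ (topH<n i) le)
  ... | no _ rewrite Bm | n∸n≡0 n = sym (+-identityʳ (topH i))
  canonStart≐conf w | vbot j rewrite isTop-bottom j with m ≤? botH j
  ... | yes le = ⊥-elim (<⇒≱ (botH<m j) le)
  ... | no _ rewrite An | n∸n≡0 t = sym (+-identityʳ (suc (botH j)))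

  canon-invariant : ∀ k → Inv (Xs k) (Ys k) × (canonConf m n u k ≐ conf (Xs k) (Ys k))
  canon-invariant zero = (≤-trans (A≤t n) (n≤1+n t) , B≤n m) , canonStart≐conf
  canon-invariant (suc k) with sideOf k | canon-invariant k
  ... | false | (ay , bx) , ce =
    (≤-refl , ≤-trans (B-mono ay) bx) , bottom-round (Xs k) (Ys k) (ay , bx) (canonConf m n u k) ce
  ... | true  | (ay , bx) , ce =
    (≤-trans (A-mono bx) ay , ≤-refl) , top-round (Xs k) (Ys k) (ay , bx) (canonConf m n u k) ce

  canonCount-bottom : ∀ k → sideOf k ≡ false → canonCount m n u k ≡ B (Xs k) ∸ B (A (Ys k))
  canonCount-bottom k e with canon-invariant k
  ... | (ay , bx) , ce rewrite e = size-bottom-round (Xs k) (Ys k) ay (canonConf m n u k) ce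

  canonCount-top : ∀ k → sideOf k ≡ true → canonCount m n u k ≡ A (Ys k) ∸ A (B (Xs k))
  canonCount-top k e with canon-invariant k
  ... | (ay , bx) , ce rewrite e = size-top-round (Xs k) (Ys k) bx (canonConf m n u k) ce

  Ys-before-bottom : ∀ k → sideOf k ≡ false → Ys k ≡ B (Xs k)
  Ys-before-bottom zero _ = sym Bm
  Ys-before-bottom (suc k) e with sideOf k in eq
  ... | true  = refl
  ... | false with () ← trans (sym e) (trans (sideOf-suc k) (cong not eq))

  Xs-before-top : ∀ k → sideOf k ≡ true → Xs k ≡ A (Ys k)
  Xs-before-top zero ()
  Xs-before-top (suc k) e with sideOf k in eq
  ... | false = refl
  ... | true with () ← trans (sym e) (trans (sideOf-suc k) (cong not eq))

  stable-resp : ∀ c c' → c ≐ c' → IsStable m n c → IsStable m n c'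
  stable-resp c c' e s v = subst (_< degree v) (e v) (s v)

  -- conf X Y is stable iff neither round would topple anything
  conf-stable : ∀ X Y → Inv X Y → A Y ≤ A (B X) → B X ≤ B (A Y) → IsStable m n (conf X Y)
  conf-stable X Y (ay , bx) h1 h2 w with view w
  ... | vtop i = subst₂ _<_ (sym (conf-top X Y i)) (sym (degree-top i)) stays
    where
    stays : confTop X Y (topH i) < n
    stays with Y ≤? topH i
    ... | yes _ = a∸b<M (topH i) (B X) (topH<n i)
    ... | no ¬yp with B X ≤? topH i
    ... | yes bp = ⊥-elim (<⇒≱ (subst₂ _<_ (sym (A-count (B X))) (sym (A-count Y))
                     (TA.countBelow-strict (allFin t) i (∈-allFin i) bp (≰⇒> ¬yp))) h1)
    ... | no ¬bp = subst (topH i + (n ∸ B X) <_) (m+[n∸m]≡n (B≤n X)) (+-monoˡ-< (n ∸ B X) (≰⇒> ¬bp))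
  ... | vbot j = subst₂ _<_ (sym (conf-bottom X Y j)) (sym (degree-bottom j)) stays
    where
    stays : confBot X Y (botH j) < m
    stays with X ≤? botH j
    ... | yes _ = a∸b<M (botH j) (A Y) (botH<m j)
    ... | no ¬xq with A Y ≤? botH j
    ... | yes aq = ⊥-elim (<⇒≱ (subst₂ _<_ (sym (B-count (A Y))) (sym (B-count X))
                     (TB.countBelow-strict (allFin n) j (∈-allFin j) aq (≰⇒> ¬xq))) h2)
    ... | no ¬aq = s≤s (subst (botH j + (t ∸ A Y) <_) (m+[n∸m]≡n (A≤t Y)) (+-monoˡ-< (t ∸ A Y) (≰⇒> ¬aq)))

  conf-unstable-top : ∀ X Y → Inv X Y → A (B X) < A Y → ¬ IsStable m n (conf X Y)
  conf-unstable-top X Y (ay , bx) lt s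
    with TA.countBelow-witness (allFin t) bx (subst₂ _<_ (A-count (B X)) (A-count Y) lt)
  ... | i , _ , b , a =
    <⇒≱ (s (top i)) (subst₂ _≤_ (sym (degree-top i)) (sym (conf-top X Y i)) (confTop-unstable⁺ X Y (topH i) a b))

  conf-unstable-bottom : ∀ X Y → Inv X Y → B (A Y) < B X → ¬ IsStable m n (conf X Y)
  conf-unstable-bottom X Y (ay , bx) lt s
    with TB.countBelow-witness (allFin n) ay (subst₂ _<_ (B-count (A Y)) (B-count X) lt)
  ... | j , _ , b , a =
    <⇒≱ (s (bottom j)) (subst₂ _≤_ (sym (degree-bottom j)) (sym (conf-bottom X Y j)) (confBot-unstable⁺ X Y (botH j) a b))

  conf-final : ∀ X Y → A Y ≡ 0 → B X ≡ 0 → conf X Y ≐ u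
  conf-final X Y ea eb w with view w
  ... | vtop i = trans (conf-top X Y i) same
    where
    same : confTop X Y (topH i) ≡ topH i
    same with Y ≤? topH i
    ... | yes _ rewrite eb = refl
    ... | no ¬yp = ⊥-elim (<⇒≱ (subst₂ _<_ (sym (A-count 0)) (sym (A-count Y))
                     (TA.countBelow-strict (allFin t) i (∈-allFin i) z≤n (≰⇒> ¬yp))) (subst (_≤ A 0) (sym ea) z≤n))
  ... | vbot j = trans (conf-bottom X Y j) same
    where
    same : confBot X Y (botH j) ≡ botH j
    same with X ≤? botH j
    ... | yes _ rewrite ea = refl
    ... | no ¬xq = ⊥-elim (<⇒≱ (subst₂ _<_ (sym (B-count 0)) (sym (B-count X))
                     (TB.countBelow-strict (allFin n) j (∈-allFin j) z≤n (≰⇒> ¬xq))) (subst (_≤ B 0) (sym eb) z≤n))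

module ConditionC (t n : ℕ) (u : Config (suc t) n) (stable : IsStable (suc t) n u) (n≥1 : 1 ≤ n) where
  open Sandpile t n
  open Heights t n u stable

  CondC : Set
  CondC = ∀ X → 1 ≤ X → X < m → A (B X) < X

  module UnderC (Cc : CondC) where

    CondC-≤ : ∀ X → X < m → A (B X) ≤ X
    CondC-≤ zero    _  rewrite B0 | A0 = z≤n
    CondC-≤ (suc X) lt = <⇒≤ (Cc (suc X) (s≤s z≤n) lt)

    zero-by-C : ∀ X → X < m → X ≤ A (B X) → X ≡ 0
    zero-by-C zero    _  _  = refl
    zero-by-C (suc X) lt le = ⊥-elim (<⇒≱ (Cc (suc X) (s≤s z≤n) lt) le)

    B<n : ∀ x → x < m → B x < n
    B<n x lt with B x <? n
    ... | yes p = p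
    ... | no ¬p = ⊥-elim (full x lt (≤-antisym (B≤n x) (≮⇒≥ ¬p)))
      where
      full : ∀ x → x < m → B x ≡ n → ⊥
      full zero    _  e = <⇒≢ n≥1 (trans (sym B0) e)
      full (suc x) lt e = <⇒≱ (Cc (suc x) (s≤s z≤n) lt) (subst (suc x ≤_) (sym (trans (cong A e) An)) (s≤s⁻¹ lt))

    module Described (U L : List NE) (desc : Describes m n (f m n u) U L) where
      open PathPair m n U L (proj₁ desc)

      InF⇒Between : ∀ x y → InF x y → Between U L x y
      InF⇒Between x y h = proj₁ (proj₂ desc x y) (InF⇒f x y h)

      Between⇒InF : ∀ x y → Between U L x y → InF x y
      Between⇒InF x y h = f⇒InF x y (proj₂ (proj₂ desc x y) h)

      lower-east-height : ∀ x → x < m → ∀ {h} → (x , h) ∈ eastSteps L → h ≡ B x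
      lower-east-height x lt {h} el with east-U x lt
      ... | hu , eu = ≤-antisym h≤Bx Bx≤h
        where
        Bx≤h : B x ≤ h
        Bx≤h = Between⇒InF x h ((hu , eu , lower<upper x lt el eu) , (h , el , ≤-refl)) .proj₂ .proj₂ .proj₂
        h≤Bx : h ≤ B x
        h≤Bx with InF⇒Between x (B x) (lt , B<n x lt , CondC-≤ x lt , ≤-refl)
        ... | _ , (h' , el' , le) = subst (_≤ B x) (east-unique 0 0 L el' el) le

      lower-east : ∀ x → x < m → (x , B x) ∈ eastSteps L
      lower-east x lt with east-L x lt
      ... | h , el = subst (λ z → (x , z) ∈ eastSteps L) (lower-east-height x lt el) el

      below-upper : ∀ x → x < m → ∀ {hu} → (x , hu) ∈ eastSteps U → ∀ y → y < n → A y ≤ x → y < hu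
      below-upper x lt {hu} eu y yn ay with B x ≤? y
      ... | yes bx with InF⇒Between x y (lt , yn , ay , bx)
      ...   | (h' , eu' , l) , _ = subst (y <_) (east-unique 0 0 U eu' eu) l
      below-upper x lt {hu} eu y yn ay | no ¬bx = <-trans (≰⇒> ¬bx) (lower<upper x lt (lower-east x lt) eu)

      below-upper⁻ : ∀ x → x < m → ∀ {hu} → (x , hu) ∈ eastSteps U → ∀ y → y < hu → B x ≤ y → A y ≤ x
      below-upper⁻ x lt {hu} eu y yh bx =
        proj₁ (proj₂ (proj₂ (Between⇒InF x y ((hu , eu , yh) , (B x , lower-east x lt , bx)))))

      -- Where the bounce path turns.  Going south in column x it meets L at height
      -- B x; going west in row B x it meets U in column A (B x).

      lower-corner : ∀ x y → x < m → B x < y → (x , B x) ∈ vertices L ×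
        (∀ j → 1 ≤ j → j < y ∸ B x → (x , y ∸ j) ∉ vertices L)
      lower-corner x y lt by =
        proj₁ (east-endpoints 0 0 L (lower-east x lt)) ,
        λ j _ jl v → <⇒≱ (j<y∸b⇒b<y∸j jl) (vertex-below-east 0 0 L v (lower-east x lt))

      upper-corner : ∀ x → x < m → (A (B x) , B x) ∈ vertices U
      upper-corner x lt = corner (A (B x)) refl
        where
        y : ℕ
        y = B x
        col<m : ∀ {a} → a ≤ A y → a < m
        col<m a≤ = ≤-<-trans (≤-trans a≤ (CondC-≤ x lt)) lt
        -- the east step of U in column A y lies above row y ...
        above : ∀ {a h} → a ≡ A y → (a , h) ∈ eastSteps U → y ≤ h
        above e eu = <⇒≤ (below-upper _ (col<m (≤-reflexive e)) eu y (B<n x lt) (≤-reflexive (sym e)))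
        -- ... and the one in the column before it does not
        corner : ∀ a → a ≡ A y → (a , y) ∈ vertices U
        corner zero e with east-U 0 (col<m (≤-reflexive e))
        ... | h , eu = vertex-interval 0 0 U (vertex-start 0 0 U) (proj₁ (east-endpoints 0 0 U eu)) z≤n (above e eu)
        corner (suc a) e with east-U (suc a) (col<m (≤-reflexive e)) | east-U a (col<m (<⇒≤ (≤-reflexive e)))
        ... | h , eu | h' , eu' =
          vertex-interval 0 0 U (proj₂ (east-endpoints 0 0 U eu')) (proj₁ (east-endpoints 0 0 U eu)) h'≤y (above e eu)
          where
          h'≤y : h' ≤ y
          h'≤y with h' ≤? y
          ... | yes p = p
          ... | no ¬p = ⊥-elim (<⇒≱ (≤-reflexive e) (below-upper⁻ a (col<m (<⇒≤ (≤-reflexive e))) eu' y (≰⇒> ¬p)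
                          (B-mono (≤-trans (<⇒≤ (≤-reflexive e)) (CondC-≤ x lt)))))

      upper-avoids-row : ∀ x → x < m → ∀ z → A (B x) < z → z ≤ x → (z , B x) ∉ vertices U
      upper-avoids-row x lt (suc z) a<z z≤x v with east-U z (≤-<-trans (n≤1+n z) (≤-<-trans z≤x lt))
      ... | h , eu = <⇒≱ (below-upper z (≤-<-trans (n≤1+n z) (≤-<-trans z≤x lt)) eu (B x) (B<n x lt) (s≤s⁻¹ a<z))
                        (vertex-above-east 0 0 U v eu)

      southStep : ∀ x y cs → x < m → B x < y → y ≤ n → Bounce U L west x (B x) cs →
        Bounce U L south x y ((y ∸ B x) ∷ cs)
      southStep x y cs lt by yn b with lower-corner x y lt by
      ... | v , nv = southRun (y ∸ B x) (m<n⇒0<n∸m by) (m∸n≤m y (B x))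
          (subst (λ z → (x , z) ∈ vertices L) (sym (m∸[m∸n]≡n (<⇒≤ by))) v) nv
          (subst (λ z → Bounce U L west x z cs) (sym (m∸[m∸n]≡n (<⇒≤ by))) b)

      westStep : ∀ x cs → x < m → A (B x) < x → Bounce U L south (A (B x)) (B x) cs →
        Bounce U L west x (B x) ((x ∸ A (B x)) ∷ cs)
      westStep x cs lt ab b = westRun (x ∸ A (B x)) (m<n⇒0<n∸m ab) (m∸n≤m x (A (B x)))
          (subst (λ z → (z , B x) ∈ vertices U) (sym (m∸[m∸n]≡n (<⇒≤ ab))) (upper-corner x lt))
          (λ j _ jl → upper-avoids-row x lt (x ∸ j) (j<y∸b⇒b<y∸j jl) (m∸n≤m x j))
          (subst (λ z → Bounce U L south z (B x) cs) (sym (m∸[m∸n]≡n (<⇒≤ ab))) b)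

    -- A bottom round
    -- from (X , Y) with Y = B X topples B X ∸ B (A Y) vertices, which is the
    -- south run from (A Y , Y) down to L, and a top round from (X , Y) with
    -- X = A Y topples A Y ∸ A (B X) vertices, the west run from (X , B X) to U.
    module BounceIsCanonical (U L : List NE) (desc : Describes m n (f m n u) U L) where
      open Described U L desc

      Stab : ℕ → Set
      Stab k = IsStable m n (canonConf m n u k)

      -- started at round j, the process stops after exactly r more rounds, at
      -- thresholds with A Y = B X = 0 (where conf X Y is u)
      Ends : ℕ → ℕ → Set
      Ends j r = Stab (j + r) × (∀ i → i < r → ¬ Stab (j + i)) × A (Ys (j + r)) ≡ 0 × B (Xs (j + r)) ≡ 0

      Rest : ℕ → Dir → ℕ → ℕ → Set
      Rest j d x y = Σ ℕ λ r → Ends j r × Bounce U L d x y (map (canonCount m n u) (range j r))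

      ends-now : ∀ j → Stab j → A (Ys j) ≡ 0 → B (Xs j) ≡ 0 → Ends j 0
      ends-now j s a0 b0 =
        subst Stab j≡ s , (λ i ()) , subst (λ z → A (Ys z) ≡ 0) j≡ a0 , subst (λ z → B (Xs z) ≡ 0) j≡ b0
        where
        j≡ : j ≡ j + 0
        j≡ = sym (+-identityʳ j)

      ends-later : ∀ j → ¬ Stab j → ∀ r → Ends (suc j) r → Ends j (suc r)
      ends-later j ns r (s , us , a0 , b0) =
        subst Stab j≡ s ,
        (λ { zero _ → subst (λ z → ¬ Stab z) (sym (+-identityʳ j)) ns
           ; (suc i) (s≤s il) → subst (λ z → ¬ Stab z) (sym (+-suc j i)) (us i il) }) ,
        subst (λ z → A (Ys z) ≡ 0) j≡ a0 , subst (λ z → B (Xs z) ≡ 0) j≡ b0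
        where
        j≡ : suc j + r ≡ j + suc r
        j≡ = sym (+-suc j r)

      stop-at-origin : ∀ {d x y} → x ≡ 0 → y ≡ 0 → Bounce U L d x y []
      stop-at-origin refl refl = stop

      after-bottom : ∀ j → sideOf j ≡ false → Xs (suc j) ≡ A (Ys j) × Ys (suc j) ≡ Ys j × sideOf (suc j) ≡ true
      after-bottom j e rewrite sideOf-suc j | e = refl , refl , refl

      after-top : ∀ j → sideOf j ≡ true → Xs (suc j) ≡ Xs j × Ys (suc j) ≡ B (Xs j) × sideOf (suc j) ≡ false
      after-top j e rewrite sideOf-suc j | e = refl , refl , refl

      -- a bottom round that topples nothing: then X = Y = 0 and we are done
      stopped-at-bottom : ∀ j → sideOf j ≡ false → ¬ B (A (Ys j)) < Ys j → Rest j south (A (Ys j)) (Ys j)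
      stopped-at-bottom j e ¬by with canon-invariant j | Ys-before-bottom j e
      ... | (ay , bx) , ce | yB = 0 , ends-now j st0 x0 (trans (sym yB) y0) , stop-at-origin x0 y0
        where
        x : ℕ
        x = A (Ys j)
        Bx≡Y : B x ≡ Ys j
        Bx≡Y = ≤-antisym (subst (B x ≤_) (sym yB) (B-mono ay)) (≮⇒≥ ¬by)
        x0 : x ≡ 0
        x0 = zero-by-C x (A<m (Ys j)) (≤-reflexive (sym (cong A Bx≡Y)))
        y0 : Ys j ≡ 0
        y0 = trans (sym Bx≡Y) (trans (cong B x0) B0)
        st0 : Stab j
        st0 = stable-resp _ _ (λ w → sym (ce w))
                (conf-stable (Xs j) (Ys j) (ay , bx) (≤-reflexive (cong A yB)) (≤-reflexive (trans (sym yB) (sym Bx≡Y))))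

      -- a top round that topples nothing: then X = 0 and we are done
      stopped-at-top : ∀ j → sideOf j ≡ true → ¬ A (B (Xs j)) < Xs j → Rest j west (Xs j) (B (Xs j))
      stopped-at-top j e ¬ab with canon-invariant j | Xs-before-top j e
      ... | (ay , bx) , ce | xA = 0 , ends-now j st0 (trans (sym xA) X0) (trans (cong B X0) B0) ,
                                  stop-at-origin X0 (trans (cong B X0) B0)
        where
        X0 : Xs j ≡ 0
        X0 = zero-by-C (Xs j) (subst (_< m) (sym xA) (A<m (Ys j))) (≮⇒≥ ¬ab)
        st0 : Stab j
        st0 = stable-resp _ _ (λ w → sym (ce w))
                (conf-stable (Xs j) (Ys j) (ay , bx) (subst (_≤ A (B (Xs j))) xA (≮⇒≥ ¬ab)) (≤-reflexive (cong B xA)))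

      -- The induction on the rounds; F is fuel bounding the remaining number of rounds
      -- (A Y + Y, resp. X + B X, decreases strictly with each effective round).
      mutual
        bounce-bottom : ∀ F j → sideOf j ≡ false → A (Ys j) + Ys j < F → Rest j south (A (Ys j)) (Ys j)
        bounce-bottom (suc F) j e lt with B (A (Ys j)) <? Ys j
        ... | no ¬by = stopped-at-bottom j e ¬by
        ... | yes by with canon-invariant j | Ys-before-bottom j e | after-bottom j e
        ...   | inv , ce | yB | eX , eY , e' with bounce-top F (suc j) e' fuel
          where
          fuel : Xs (suc j) + B (Xs (suc j)) < F
          fuel rewrite eX = <-≤-trans (+-monoʳ-< (A (Ys j)) by) (s≤s⁻¹ lt)
        ...     | r , ends , rest = suc r , ends-later j unstable-now r ends ,
          subst (λ z → Bounce U L south (A (Ys j)) (Ys j) (z ∷ map (canonCount m n u) (range (suc j) r)))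
            (sym (trans (canonCount-bottom j e) (cong (_∸ B (A (Ys j))) (sym yB))))
            (southStep (A (Ys j)) (Ys j) _ (A<m (Ys j)) by (subst (_≤ n) (sym yB) (B≤n (Xs j)))
              (subst (λ z → Bounce U L west z (B z) _) eX rest))
          where
          unstable-now : ¬ Stab j
          unstable-now st = conf-unstable-bottom (Xs j) (Ys j) inv (subst (B (A (Ys j)) <_) yB by)
                              (stable-resp _ _ ce st)

        bounce-top : ∀ F j → sideOf j ≡ true → Xs j + B (Xs j) < F → Rest j west (Xs j) (B (Xs j))
        bounce-top (suc F) j e lt with A (B (Xs j)) <? Xs j
        ... | no ¬ab = stopped-at-top j e ¬ab
        ... | yes ab with canon-invariant j | Xs-before-top j e | after-top j e
        ...   | inv , ce | xA | eX , eY , e' with bounce-bottom F (suc j) e' fuel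
          where
          fuel : A (Ys (suc j)) + Ys (suc j) < F
          fuel rewrite eY = <-≤-trans (+-monoˡ-< (B (Xs j)) ab) (s≤s⁻¹ lt)
        ...     | r , ends , rest = suc r , ends-later j unstable-now r ends ,
          subst (λ z → Bounce U L west (Xs j) (B (Xs j)) (z ∷ map (canonCount m n u) (range (suc j) r)))
            (sym (trans (canonCount-top j e) (cong (_∸ A (B (Xs j))) (sym xA))))
            (westStep (Xs j) _ (subst (_< m) (sym xA) (A<m (Ys j))) ab
              (subst (λ z → Bounce U L south (A z) z _) eY rest))
          where
          unstable-now : ¬ Stab j
          unstable-now st = conf-unstable-top (Xs j) (Ys j) inv (subst (A (B (Xs j)) <_) xA ab)
                              (stable-resp _ _ ce st)

      canonical : Rest 0 south (A n) n
      canonical = bounce-bottom (suc (A n + n)) 0 refl ≤-refl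

  -- Writing β k for k grains on every bottom vertex, canonStart = u ⊕ β 1, so the
  -- canonical topplings take u ⊕ β (k + 1) legally to u ⊕ β k (legal-⊕), and
  -- u ⊕ β k reaches u.  From u + deg, toppling every top vertex once gives
  -- u ⊕ β (m + #tops), which therefore reaches u as well.
  module ReturnsToU (r : ℕ) (returns : canonConf m n u r ≐ u) where

    canonSequence : ℕ → List Vertex
    canonSequence zero    = []
    canonSequence (suc k) = canonSequence k ++ unstable (sideOf k) (canonConf m n u k)

    canonSequence-fires : ∀ k → fireAll (canonStart m n u) (canonSequence k) ≡ canonConf m n u k
    canonSequence-fires zero    = refl
    canonSequence-fires (suc k) = trans (foldl-++ fire (canonStart m n u) (canonSequence k) _)
      (cong (λ c → fireAll c (unstable (sideOf k) (canonConf m n u k))) (canonSequence-fires k))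

    canonSequence-legal : ∀ k → Legal (canonStart m n u) (canonSequence k)
    canonSequence-legal zero    = tt
    canonSequence-legal (suc k) = legal-++ _ (canonSequence k) _ (canonSequence-legal k)
      (subst (λ c → Legal c (unstable (sideOf k) (canonConf m n u k))) (sym (canonSequence-fires k))
        (proj₁ (round (sideOf k) (canonConf m n u k))))

    bottomGrains : ℕ → Cfg
    bottomGrains k w = if top? w then 0 else k

    repeat : ℕ → List Vertex → List Vertex
    repeat zero    vs = []
    repeat (suc k) vs = vs ++ repeat k vs

    Vs : List Vertex
    Vs = canonSequence r

    u⊕β≐canonStart⊕β : ∀ k → (u ⊕ bottomGrains (suc k)) ≐ (canonStart m n u ⊕ bottomGrains k)
    u⊕β≐canonStart⊕β k w with top? w
    ... | true  = refl
    ... | false = +-suc (u w) k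

    u⊕β0≐u : (u ⊕ bottomGrains 0) ≐ u
    u⊕β0≐u w with top? w
    ... | true  = +-identityʳ (u w)
    ... | false = +-identityʳ (u w)

    bottomGrains-return : ∀ k → Legal (u ⊕ bottomGrains k) (repeat k Vs) × fireAll (u ⊕ bottomGrains k) (repeat k Vs) ≐ u
    bottomGrains-return zero = tt , u⊕β0≐u
    bottomGrains-return (suc k) with legal-⊕ (canonStart m n u) (bottomGrains k) Vs (canonSequence-legal r)
                                   | bottomGrains-return k
    ... | legal , fires | legal-k , fires-k =
      legal-resp _ _ (Vs ++ repeat k Vs) (λ w → sym (u⊕β≐canonStart⊕β k w))
        (legal-++ _ Vs (repeat k Vs) legal (legal-resp _ _ (repeat k Vs) one-pass legal-k)) ,
      λ w → trans (fireAll-resp _ _ (Vs ++ repeat k Vs) (u⊕β≐canonStart⊕β k) w)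
              (trans (fireAll-++ _ Vs (repeat k Vs) w)
                (trans (fireAll-resp _ _ (repeat k Vs) (λ v → sym (one-pass v)) w) (fires-k w)))
      where
      -- one pass of the canonical topplings removes one grain from each bottom vertex
      one-pass : (u ⊕ bottomGrains k) ≐ fireAll (canonStart m n u ⊕ bottomGrains k) Vs
      one-pass v = sym (trans (fires v)
                     (cong (_+ bottomGrains k v) (trans (cong (λ c → c v) (canonSequence-fires r)) (returns v))))

    saturated : Cfg
    saturated w = u w + degree w

    S0 : List Vertex
    S0 = unstable true saturated

    after-tops : fireAll saturated S0 ≐ (u ⊕ bottomGrains (m + length S0))
    after-tops w with round true saturated | top? w in et
    ... | _ , settles , _ | true =
      trans (settles w et) (trans (settle-≥ (m≤n+m (degree w) (u w)))
        (trans (m+n∸n≡m (u w) (degree w)) (sym (+-identityʳ (u w)))))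
    ... | _ , _ , gains | false =
      trans (gains w (not-¬ et))
        (trans (cong (λ z → u w + z + length S0) (cong (λ b → if b then n else m) et)) (+-assoc (u w) m (length S0)))

    full-legal : Legal saturated (S0 ++ repeat (m + length S0) Vs)
    full-legal = legal-++ saturated S0 _ (proj₁ (round true saturated))
      (legal-resp _ _ _ (λ w → sym (after-tops w)) (proj₁ (bottomGrains-return (m + length S0))))

    full-fires : fireAll saturated (S0 ++ repeat (m + length S0) Vs) ≐ u
    full-fires w = trans (fireAll-++ saturated S0 _ w)
      (trans (fireAll-resp _ _ (repeat (m + length S0) Vs) after-tops w) (proj₂ (bottomGrains-return (m + length S0)) w))

    retarget : ∀ {a b b'} → Star (Step m n) a b → b ≐ b' → (a ≐ b') ⊎ Star (Step m n) a b'
    retarget ε h = inj₁ h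
    retarget ((v , uns , eq) ◅ d) h with retarget d h
    ... | inj₂ d' = inj₂ ((v , uns , eq) ◅ d')
    ... | inj₁ h' = inj₂ ((v , uns , λ w → trans (sym (h' w)) (eq w)) ◅ ε)

    recurrent : IsRecurrent m n u
    recurrent with retarget (legal⇒star saturated _ full-legal) full-fires
    ... | inj₂ d = saturated , (λ v → m≤n+m (degree v) (u v)) , d , stable
    ... | inj₁ h = ⊥-elim (<⇒≢ (m<m+n (u v₀) (subst (0 <_) (sym (degree-bottom j₀)) (s≤s z≤n))) (sym (h v₀)))
      where
      -- the saturated configuration has extra grains on a bottom vertex
      j₀ : Fin n
      j₀ = someFin n≥1
      v₀ : Vertex
      v₀ = bottom j₀

  -- Suppose A (B X) ≥ X for some 0 < X < m and let WT be the top
  -- vertices of height < B X and WB the bottom vertices of height < X.  In a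
  -- toppling sequence from x ≥ deg to the stable u every vertex topples, so by
  -- forbidden some vertex of WT ends with ≥ |WB| = B X grains or some vertex of WB
  -- with ≥ |WT| = A (B X) ≥ X grains, contradicting the choice of WT and WB.

  lowOn : Bool → ℕ → Vertex → Bool
  lowOn s X = onSide s (λ v → below X (u v))

  low : Bool → ℕ → List Vertex
  low s X = filterᵇ (lowOn s X) (allFin (t + n))

  ∈-low⁻ : ∀ s X v → v ∈ low s X → top? v ≡ s × u v < X
  ∈-low⁻ s X v h with onSide-true⁻ s (λ v → below X (u v)) v (proj₂ (∈-filterᵇ⁻ (lowOn s X) {xs = allFin (t + n)} h))
  ... | a , b = a , below-true⁻ b

  low-sides : ∀ s X → All (λ w → top? w ≡ s) (low s X)
  low-sides s X = All-from-∈ (λ w h → proj₁ (∈-low⁻ s X w h))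

  low-unique : ∀ s X → Unique (low s X)
  low-unique s X = Unique-filterᵇ _ (allFin⁺ _)

  length-low-top : ∀ Y → length (low true Y) ≡ A Y
  length-low-top Y = trans (length-filterᵇ _ (allFin (t + n))) (trans (count-tops (λ v → below Y (u v))) (sym (A-count Y)))

  length-low-bottom : ∀ X → length (low false X) ≡ B X
  length-low-bottom X = trans (length-filterᵇ _ (allFin (t + n))) (trans (count-bottoms (λ v → below X (u v))) (sym (B-count X)))

  open import Data.List.Membership.DecPropositional (_≟F_ {t + n}) using (_∈?_)

  recurrent⇒CondC : IsRecurrent m n u → CondC
  recurrent⇒CondC (x , x≥deg , d , _) X 1≤X X<m with A (B X) <? X
  ... | yes p = p
  ... | no ¬p with forbidden d WT WB (low-unique true (B X)) (low-unique false X)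
                     (low-sides true (B X)) (low-sides false X)
                     (All-from-∈ (λ w _ → all-topple w)) (All-from-∈ (λ w _ → all-topple w)) WT-nonempty
    where
    WT WB : List Vertex
    WT = low true (B X)
    WB = low false X
    -- a vertex that never topples keeps at least deg grains, but u is stable
    all-topple : ∀ w → w ∈ toppled d
    all-topple w with w ∈? toppled d
    ... | yes p = p
    ... | no np = ⊥-elim (<⇒≱ (stable w) (≤-trans (x≥deg w)
                    (subst (_≤ u w) (+-identityʳ (x w)) (grains-received d w np [] [] [] []))))
    WT-nonempty : Σ Vertex λ w → w ∈ WT
    WT-nonempty with count-witness (lowOn true (B X)) (allFin (t + n))
                       (subst (0 <_) (length-filterᵇ _ (allFin (t + n)))
                         (subst (0 <_) (sym (length-low-top (B X))) (<-≤-trans 1≤X (≮⇒≥ ¬p))))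
    ... | v , v∈ , pv = v , ∈-filterᵇ⁺ _ v∈ pv
  ... | inj₁ (w , w∈ , le) =
    ⊥-elim (<⇒≱ (proj₂ (∈-low⁻ true (B X) w w∈)) (subst (_≤ u w) (length-low-bottom X) le))
  ... | inj₂ (w , w∈ , le) =
    ⊥-elim (<⇒≱ (<-≤-trans (proj₂ (∈-low⁻ false X w w∈)) (≮⇒≥ ¬p)) (subst (_≤ u w) (length-low-top (B X)) le))

  -- The upper path has its east step of column x at
  -- upperHeight x, the lower path at B x; then the cells between them are
  -- exactly InF, i.e. f_{m,n}(u), and condition C makes the paths meet only
  -- at their ends.

  upperHeight : ℕ → ℕ
  upperHeight x = if ⌊ x <? t ⌋ then suc (nth sT x) else n

  upperHeight⁻ : ∀ x y → y < upperHeight x → y < n × A y ≤ x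
  upperHeight⁻ x y h with x <? t
  ... | yes xt = ≤-<-trans (s≤s⁻¹ h) (sorted-index<⇒below n sT (sort-↗ _) x (subst (x <_) (sym length-sT) xt)
                   (subst (x <_) (sym (trans (count-sT n) An)) xt)) ,
                 proj₁ (A≤⇔<sT x y xt) h
  ... | no ¬xt = h , ≤-trans (A≤t y) (≮⇒≥ ¬xt)

  upperHeight⁺ : ∀ x y → y < n → A y ≤ x → y < upperHeight x
  upperHeight⁺ x y yn ay with x <? t
  ... | yes xt = proj₂ (A≤⇔<sT x y xt) ay
  ... | no _   = yn

  upperHeight-mono : ∀ a b → a ≤ b → upperHeight a ≤ upperHeight b
  upperHeight-mono a b le =
    <-bound⇒≤ (λ y h → let (yn , ay) = upperHeight⁻ a y h in upperHeight⁺ b y yn (≤-trans ay le))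

  upperHeight≤n : ∀ a → upperHeight a ≤ n
  upperHeight≤n a = <-bound⇒≤ (λ y h → proj₁ (upperHeight⁻ a y h))

  upperHeight-last : upperHeight t ≡ n
  upperHeight-last with t <? t
  ... | yes p = ⊥-elim (<-irrefl refl p)
  ... | no _  = refl

  module UP = PathFromHeights n upperHeight upperHeight-mono upperHeight≤n
  module LP = PathFromHeights n B (λ a b → B-mono) B≤n

  upperPath lowerPath : List NE
  upperPath = UP.path m
  lowerPath = LP.path m

  CondC⇒pathPair : CondC → IsPathPair m n upperPath lowerPath
  CondC⇒pathPair Cc =
    UP.path-isPath m , LP.path-isPath m ,
    UP.path-startsN t (upperHeight⁺ 0 0 n≥1 (≤-reflexive A0)) , LP.path-startsE t B0 ,
    paths-meet-only-at-ends t n upperPath lowerPath upperHeight B (UP.path-isPath m) (LP.path-isPath m)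
      (UP.path-east⁺ m) (LP.path-east⁺ m) B0 upperHeight-last
      (λ x lt → upperHeight⁺ x (B (suc x)) (UnderC.B<n Cc (suc x) lt) (s≤s⁻¹ (Cc (suc x) (s≤s z≤n) lt)))

  CondC⇒polyomino : CondC → IsParallelogramPolyomino m n (f m n u)
  CondC⇒polyomino Cc = upperPath , lowerPath , CondC⇒pathPair Cc , λ x y → to x y , from x y
    where
    to : ∀ x y → f m n u x y → Between upperPath lowerPath x y
    to x y h with f⇒InF x y h
    ... | xm , yn , ay , bx = (upperHeight x , UP.path-east⁺ m x xm , upperHeight⁺ x y yn ay) ,
                              (B x , LP.path-east⁺ m x xm , bx)
    from : ∀ x y → Between upperPath lowerPath x y → f m n u x y
    from x y ((h , eh , yh) , (h' , eh' , hy)) with UP.path-east⁻ m eh | LP.path-east⁻ m eh'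
    ... | xm , refl | _ , refl = InF⇒f x y (xm , upperHeight⁻ x y yh .proj₁ , upperHeight⁻ x y yh .proj₂ , hy)

  -- Conversely, with hl the height of L in column x + 1, the cell (x + 1 , hl)
  -- gives B (x + 1) ≤ hl and the cell (x , hl) gives A hl ≤ x.
  polyomino⇒CondC : ∀ U L → Describes m n (f m n u) U L → CondC
  polyomino⇒CondC U L (pp , cells) = condC
    where
    open PathPair m n U L pp
    condC : CondC
    condC (suc x) _ X<m with east-L (suc x) X<m | east-U (suc x) X<m | east-U x (<-trans (n<1+n x) X<m)
                           | east-L x (<-trans (n<1+n x) X<m)
    ... | hl , el | hu , eu | hu' , eu' | hlx , elx = s≤s (≤-trans (A-mono B≤hl) A≤x)
      where
      B≤hl : B (suc x) ≤ hl
      B≤hl = f⇒InF (suc x) hl (proj₂ (cells (suc x) hl)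
               ((hu , eu , lower<upper (suc x) X<m el eu) , (hl , el , ≤-refl))) .proj₂ .proj₂ .proj₂
      A≤x : A hl ≤ x
      A≤x = f⇒InF x hl (proj₂ (cells x hl)
              ((hu' , eu' , lower-next<upper x X<m el eu') , (hlx , elx , east-mono 0 0 L elx el (n≤1+n x))))
            .proj₂ .proj₂ .proj₁

  -- Under C the canonical toppling ends in u (after the rounds of the bounce path).
  CondC⇒recurrent : CondC → IsRecurrent m n u
  CondC⇒recurrent Cc with CondC⇒polyomino Cc
  ... | U , L , desc with UnderC.BounceIsCanonical.canonical Cc U L desc
  ... | r , (_ , _ , a0 , b0) , _ =
    ReturnsToU.recurrent r (λ w → trans (proj₂ (canon-invariant r) w) (conf-final (Xs r) (Ys r) a0 b0 w))

  CondC⇒bounce≡canontop : CondC → ∀ U L → Describes m n (f m n u) U L →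
    Σ (List ℕ) λ cs → IsBounce m n U L cs × IsCanonTop m n u cs
  CondC⇒bounce≡canontop Cc U L desc with UnderC.BounceIsCanonical.canonical Cc U L desc
  ... | r , (s , us , _ , _) , bounce =
    map (canonCount m n u) (range 0 r) ,
    subst (λ z → Bounce U L south z n (map (canonCount m n u) (range 0 r))) An bounce ,
    r , s , us , cong (map (canonCount m n u)) (sym (applyUpTo≡range (λ i → i) 0 r (λ i → refl)))

mainTheorem1 : (m n : ℕ) → 1 ≤ m → 1 ≤ n → (u : Config m n) → IsStable m n u →
    ((IsRecurrent m n u → IsParallelogramPolyomino m n (f m n u)) ×
     (IsParallelogramPolyomino m n (f m n u) → IsRecurrent m n u))
    ×
    (IsRecurrent m n u → (U L : List NE) → Describes m n (f m n u) U L →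
      Σ (List ℕ) λ cs → IsBounce m n U L cs × IsCanonTop m n u cs)
mainTheorem1 (suc t) n _ n≥1 u stable =
  ( (λ rec → CondC⇒polyomino (recurrent⇒CondC rec))
  , (λ (U , L , desc) → CondC⇒recurrent (polyomino⇒CondC U L desc)) )
  , (λ rec → CondC⇒bounce≡canontop (recurrent⇒CondC rec))
  where open ConditionC t n u stable n≥1
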